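{- Given nonnegative integers $j,i,j',i',j'',i''$ satisfying $i'-j=i''-j'=i-j''$, the quantity $u^{j,i,j',i',j'',i''}$ is invariant under the natural action of the dihedral group $D_6$ (symmetries of a hexagon) on its six variables arranged cyclically in the order $j,i,j',i',j'',i''$.
   Context: Let $\phi_i=\prod_{r=1}^{i}(1-t^r)$ and define \[ u^{j,i,j',i',j'',i''}=\frac{\phi_{i+j}}{\phi_i\phi_{i'}\phi_{i''}\phi_j\phi_{j''}}\,{}_2\phi_1\!\left({t^{ -i},t^{ -i'}\atop t^{ -(i+j)}};t,t^{i''+1}\right), \] where ${}_2\phi_1\left({t^{ -i},t^{ -i'}\atop t^{ -(i+j)}};t,t^{i''+1}\right)=\sum_{n=0}^{\min(i,i')}\frac{(t^{ -i};t)_n(t^{ -i'};t)_n}{(t;t)_n(t^{ -(i+j)};t)_n}t^{n(i''+1)}$ is a terminating basic hypergeometric series. The weight conservation condition $i'-j=i''-j'=i-j''$ is itself invariant under this dihedral action. The symmetries include the reflections $(j,i,j',i',j'',i'')\mapsto(j'',i',j',i,j,i'')$ and $(j,i,j',i',j'',i'')\mapsto(i',j'',i'',j,i,j')$ and the cyclic shift $(j,i,j',i',j'',i'')\mapsto(j',i',j'',i'',j,i)$. -}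

module Defs where

open import Data.Nat as ℕ using (ℕ; zero; suc)
open import Data.Integer as ℤ using (ℤ; +_; -[1+_])
open import Data.List using (List; []; _∷_; replicate)
open import Data.List.Relation.Unary.All using (All)
open import Data.Fin using (Fin; toℕ; fromℕ<; #_)
open import Data.Nat.DivMod using (_%_; m%n<n)
open import Data.Bool using (Bool; true; false)
open import Data.Product using (_×_; _,_)
open import Relation.Binary.PropositionalEquality using (_≡_)

-- Polynomials in one variable t with integer coefficients,
-- represented by their coefficient lists (constant term first).

Poly : Set
Poly = List ℤ

infixl 6 _+P_
infixl 7 _*P_ _·P_

_+P_ : Poly → Poly → Poly
[]       +P q        = q
p        +P []       = p
(a ∷ p)  +P (b ∷ q)  = (a ℤ.+ b) ∷ (p +P q)

_·P_ : ℤ → Poly → Poly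
c ·P []      = []
c ·P (a ∷ p) = (c ℤ.* a) ∷ (c ·P p)

_*P_ : Poly → Poly → Poly
[]      *P q = []
(a ∷ p) *P q = (a ·P q) +P (ℤ.+ 0 ∷ (p *P q))

-P_ : Poly → Poly
-P p = ℤ.- (ℤ.+ 1) ·P p

monoP : ℕ → Poly
monoP n = replicate n (ℤ.+ 0) Data.List.++ (ℤ.+ 1 ∷ [])

oneP : Poly
oneP = ℤ.+ 1 ∷ []

IsZeroP : Poly → Set
IsZeroP p = All (_≡ ℤ.+ 0) p

-- Rational functions in t over ℚ, as fractions numerator / denominator
-- of integer polynomials.

RatFun : Set
RatFun = Poly × Poly

infixl 6 _+R_ _-R_
infixl 7 _*R_ _/R_
infix 4 _≈R_

_+R_ : RatFun → RatFun → RatFun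
(a , b) +R (c , d) = (a *P d +P c *P b , b *P d)

_-R_ : RatFun → RatFun → RatFun
(a , b) -R (c , d) = (a *P d +P -P (c *P b) , b *P d)

_*R_ : RatFun → RatFun → RatFun
(a , b) *R (c , d) = (a *P c , b *P d)

_/R_ : RatFun → RatFun → RatFun
(a , b) /R (c , d) = (a *P d , b *P c)

zeroR oneR : RatFun
zeroR = ([] , oneP)
oneR  = (oneP , oneP)

_≈R_ : RatFun → RatFun → Set
(a , b) ≈R (c , d) = IsZeroP (a *P d +P -P (c *P b))

tpow : ℤ → RatFun
tpow (+ n)     = (monoP n , oneP)
tpow -[1+ n ]  = (oneP , monoP (suc n))

sumR : ℕ → (ℕ → RatFun) → RatFun
sumR zero    f = zeroR
sumR (suc n) f = sumR n f +R f n

prodR : ℕ → (ℕ → RatFun) → RatFun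
prodR zero    f = oneR
prodR (suc n) f = prodR n f *R f n

φ : ℕ → RatFun
φ i = prodR i (λ r → oneR -R tpow (+ suc r))

poch : RatFun → ℕ → RatFun
poch a n = prodR n (λ k → oneR -R a *R tpow (+ k))

-- terminating 2φ1( t^{-i}, t^{-i'} ; t^{-m} ; t, t^{c} )
--   = Σ_{n=0}^{min(i,i')} (t^{-i};t)_n (t^{-i'};t)_n / ((t;t)_n (t^{-m};t)_n) · t^{n c}
phi21 : ℕ → ℕ → ℕ → ℕ → RatFun
phi21 i i' m c =
  sumR (suc (ℕ._⊓_ i i'))
    (λ n → ((poch (tpow (ℤ.- (+ i))) n *R poch (tpow (ℤ.- (+ i'))) n)
             /R (poch (tpow (+ 1)) n *R poch (tpow (ℤ.- (+ m))) n))
           *R tpow (+ (n ℕ.* c)))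

u : ℕ → ℕ → ℕ → ℕ → ℕ → ℕ → RatFun
u j i j' i' j'' i'' =
  (φ (i ℕ.+ j) /R (φ i *R φ i' *R φ i'' *R φ j *R φ j''))
  *R phi21 i i' (i ℕ.+ j) (suc i'')

-- Six variables arranged cyclically: position 0,1,2,3,4,5 ↦ j,i,j',i',j'',i''.

uHex : (Fin 6 → ℕ) → RatFun
uHex x = u (x (# 0))
           (x (# 1))
           (x (# 2))
           (x (# 3))
           (x (# 4))
           (x (# 5))

Weight : (Fin 6 → ℕ) → Set
Weight x = (((+ x3) ℤ.- (+ x0)) ≡ ((+ x5) ℤ.- (+ x2)))
         × (((+ x5) ℤ.- (+ x2)) ≡ ((+ x1) ℤ.- (+ x4)))
  where
  x0 = x (# 0)
  x1 = x (# 1)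
  x2 = x (# 2)
  x3 = x (# 3)
  x4 = x (# 4)
  x5 = x (# 5)

-- The dihedral group D6 (order 12) acting on hexagon positions:
-- an element is (r , b), acting on positions by k ↦ r + (±k) mod 6,
-- with the sign − iff b = true (a reflection).

D6 : Set
D6 = Fin 6 × Bool

mod6 : ℕ → Fin 6
mod6 n = fromℕ< (m%n<n n 6)

actPos : D6 → Fin 6 → Fin 6
actPos (r , false) k = mod6 (toℕ r ℕ.+ toℕ k)
actPos (r , true)  k = mod6 (toℕ r ℕ.+ (6 ℕ.∸ toℕ k))

act : D6 → (Fin 6 → ℕ) → (Fin 6 → ℕ)
act g x k = x (actPos g k)

module Submission where

-- All computations take place in the field ℚ(t), built below as fractions of
-- integer polynomials, with the convention 1/φ_z = 0 for z < 0 so that every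
-- sum can run over a fixed range.  The proof has four steps.
--  1. Expanding the q-Pochhammer symbols, u = Σ_n τ(n) with
--       τ(n) = (-1)^n t^{n j' + n(n+1)/2} φ_{i+j-n} / (φ_n φ_{i-n} φ_{i'-n} φ_{i''} φ_j φ_{j''}),
--     since the terms on both sides have equal first terms and equal ratios.
--  2. u satisfies the contiguous relation
--       u(j,i-1,j',i',j''-1,i'') + t^{j''} u(j,i-1,j',i'-1,j'',i''-1) = (1 - t^i) u(j,i,j',i',j'',i''):
--     the corresponding combination of τ-sums telescopes.
--  3. The sum T = Σ_k t^{k(k+d)} / (φ_k φ_{k+d} φ_{j-k} φ_{j'-k} φ_{j''-k}), d = i - j'',
--     satisfies the same relation and agrees with u at i = 0.  Since 1 - t^i ≠ 0,
--     the relation determines a balanced family from its values at i = 0; so u = T.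
--  4. T is symmetric in j, j', j'' and invariant under (j, j', j'', d) ↦ (j+d, j'+d, j''+d, -d).
--     This gives invariance under one reflection and the rotation by one step,
--     which generate D6.

open import Defs
open import Level using (0ℓ)
open import Data.Nat as ℕ using (ℕ; zero; suc; _≤_; _<_; z≤n; s≤s; _⊓_; _⊔_)
import Data.Nat.Properties as ℕP
open import Data.Integer as ℤ using (ℤ; +_; -[1+_])
import Data.Integer.Properties as ℤP
open import Data.Integer.Solver using (module +-*-Solver)
open import Data.List using ([]; _∷_)
open import Data.List.Relation.Unary.All using ([]; _∷_)
open import Data.Fin using (Fin; #_)
import Data.Fin as Fin
open import Data.Bool using (true; false)
open import Data.Product using (_×_; _,_; proj₁; proj₂; ∃)
open import Data.Sum using (inj₁; inj₂)
open import Data.Empty using (⊥-elim)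
open import Relation.Nullary using (¬_; yes; no)
open import Relation.Binary.Definitions using (tri<; tri≈; tri>)
open import Relation.Binary.PropositionalEquality
  using (_≡_; refl; sym; trans; cong; cong₂; subst; subst₂; module ≡-Reasoning)
open import Algebra.Bundles using (CommutativeRing; RawRing)
open import Algebra.Solver.Ring.AlmostCommutativeRing using (fromCommutativeRing; _-Raw-AlmostCommutative⟶_)

module Polynomials where
  -- Equality of integer polynomials is equality of all coefficients; the
  -- list representation itself is not canonical (trailing zeros).
  coeff : Poly → ℕ → ℤ
  coeff []      n       = + 0
  coeff (a ∷ p) zero    = a
  coeff (a ∷ p) (suc n) = coeff p n

  infix 4 _≋_
  record _≋_ (p q : Poly) : Set where
    constructor mk
    field at : ∀ n → coeff p n ≡ coeff q n
  open _≋_ public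

  ≋-refl : ∀ {p} → p ≋ p
  ≋-refl = mk λ _ → refl

  ≋-sym : ∀ {p q} → p ≋ q → q ≋ p
  ≋-sym e = mk λ n → sym (at e n)

  ≋-trans : ∀ {p q r} → p ≋ q → q ≋ r → p ≋ r
  ≋-trans e f = mk λ n → trans (at e n) (at f n)

  ≡⇒≋ : ∀ {p q} → p ≡ q → p ≋ q
  ≡⇒≋ refl = ≋-refl

  ∷-cong : ∀ {a b p q} → a ≡ b → p ≋ q → (a ∷ p) ≋ (b ∷ q)
  ∷-cong e f = mk λ { zero → e ; (suc n) → at f n }

  tail-≋ : ∀ {a b p q} → (a ∷ p) ≋ (b ∷ q) → p ≋ q
  tail-≋ e = mk λ n → at e (suc n)

  tail-zero : ∀ {a r} → a ∷ r ≋ [] → r ≋ []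
  tail-zero e = mk λ n → at e (suc n)

  shift-zero : ∀ {r} → r ≋ [] → + 0 ∷ r ≋ []
  shift-zero e = mk λ { zero → refl ; (suc n) → at e n }

  coeff-+ : ∀ p q n → coeff (p +P q) n ≡ coeff p n ℤ.+ coeff q n
  coeff-+ []      q       n       = sym (ℤP.+-identityˡ _)
  coeff-+ (a ∷ p) []      n       = sym (ℤP.+-identityʳ _)
  coeff-+ (a ∷ p) (b ∷ q) zero    = refl
  coeff-+ (a ∷ p) (b ∷ q) (suc n) = coeff-+ p q n

  coeff-· : ∀ c p n → coeff (c ·P p) n ≡ c ℤ.* coeff p n
  coeff-· c []      n       = sym (ℤP.*-zeroʳ c)
  coeff-· c (a ∷ p) zero    = refl
  coeff-· c (a ∷ p) (suc n) = coeff-· c p n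

  coeff-neg : ∀ p n → coeff (-P p) n ≡ ℤ.- coeff p n
  coeff-neg p n = trans (coeff-· _ p n) (ℤP.-1*i≡-i (coeff p n))

  coeff-* : ∀ a p q n → coeff ((a ∷ p) *P q) n ≡ a ℤ.* coeff q n ℤ.+ coeff (+ 0 ∷ (p *P q)) n
  coeff-* a p q n = trans (coeff-+ (a ·P q) _ n) (cong (ℤ._+ coeff (+ 0 ∷ (p *P q)) n) (coeff-· a q n))

  +P-cong : ∀ {p p' q q'} → p ≋ p' → q ≋ q' → p +P q ≋ p' +P q'
  +P-cong {p} {p'} {q} {q'} e f = mk λ n → begin
    coeff (p +P q) n          ≡⟨ coeff-+ p q n ⟩
    coeff p n ℤ.+ coeff q n   ≡⟨ cong₂ ℤ._+_ (at e n) (at f n) ⟩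
    coeff p' n ℤ.+ coeff q' n ≡⟨ coeff-+ p' q' n ⟨
    coeff (p' +P q') n        ∎
    where open ≡-Reasoning

  ·P-cong : ∀ c {p p'} → p ≋ p' → c ·P p ≋ c ·P p'
  ·P-cong c {p} {p'} e = mk λ n →
    trans (coeff-· c p n) (trans (cong (c ℤ.*_) (at e n)) (sym (coeff-· c p' n)))

  -P-cong : ∀ {p p'} → p ≋ p' → -P p ≋ -P p'
  -P-cong = ·P-cong _

  ·P-zero : ∀ p → + 0 ·P p ≋ []
  ·P-zero p = mk λ n → trans (coeff-· _ p n) (ℤP.*-zeroˡ (coeff p n))

  0∷-* : ∀ s r → (+ 0 ∷ s) *P r ≋ + 0 ∷ (s *P r)
  0∷-* s r = +P-cong (·P-zero r) ≋-refl

  *P-zeroˡ : ∀ {p} q → p ≋ [] → p *P q ≋ []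
  *P-zeroˡ {[]}    q e = ≋-refl
  *P-zeroˡ {a ∷ p} q e = mk λ n → trans (coeff-* a p q n) (vanish n)
    where
    tail0 : + 0 ∷ (p *P q) ≋ []
    tail0 = shift-zero (*P-zeroˡ q (tail-zero e))
    vanish : ∀ n → a ℤ.* coeff q n ℤ.+ coeff (+ 0 ∷ (p *P q)) n ≡ + 0
    vanish n = trans (cong₂ ℤ._+_ (cong (ℤ._* coeff q n) (at e zero)) (at tail0 n)) refl

  *P-congˡ : ∀ {p p'} q → p ≋ p' → p *P q ≋ p' *P q
  *P-congˡ {[]}    {p'}     q e = ≋-sym (*P-zeroˡ q (≋-sym e))
  *P-congˡ {a ∷ p} {[]}     q e = *P-zeroˡ q e
  *P-congˡ {a ∷ p} {b ∷ p'} q e = mk λ n → begin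
    coeff ((a ∷ p) *P q) n                               ≡⟨ coeff-* a p q n ⟩
    a ℤ.* coeff q n ℤ.+ coeff (+ 0 ∷ (p *P q)) n         ≡⟨ cong₂ ℤ._+_ (cong (ℤ._* coeff q n) (at e zero)) (at tails n) ⟩
    b ℤ.* coeff q n ℤ.+ coeff (+ 0 ∷ (p' *P q)) n        ≡⟨ coeff-* b p' q n ⟨
    coeff ((b ∷ p') *P q) n                              ∎
    where
    open ≡-Reasoning
    tails : + 0 ∷ (p *P q) ≋ + 0 ∷ (p' *P q)
    tails = ∷-cong refl (*P-congˡ q (tail-≋ e))

  *P-congʳ : ∀ p {q q'} → q ≋ q' → p *P q ≋ p *P q'
  *P-congʳ []      e = ≋-refl
  *P-congʳ (a ∷ p) {q} {q'} e = mk λ n → begin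
    coeff ((a ∷ p) *P q) n                                ≡⟨ coeff-* a p q n ⟩
    a ℤ.* coeff q n ℤ.+ coeff (+ 0 ∷ (p *P q)) n          ≡⟨ cong₂ ℤ._+_ (cong (a ℤ.*_) (at e n)) (at tails n) ⟩
    a ℤ.* coeff q' n ℤ.+ coeff (+ 0 ∷ (p *P q')) n        ≡⟨ coeff-* a p q' n ⟨
    coeff ((a ∷ p) *P q') n                               ∎
    where
    open ≡-Reasoning
    tails : + 0 ∷ (p *P q) ≋ + 0 ∷ (p *P q')
    tails = ∷-cong refl (*P-congʳ p e)

  *P-cong : ∀ {p p' q q'} → p ≋ p' → q ≋ q' → p *P q ≋ p' *P q'
  *P-cong {p' = p'} {q = q} e f = ≋-trans (*P-congˡ q e) (*P-congʳ p' f)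

  open +-*-Solver using (solve; _:+_; _:*_; _:=_)

  +P-comm : ∀ p q → p +P q ≋ q +P p
  +P-comm p q = mk λ n →
    trans (coeff-+ p q n) (trans (ℤP.+-comm (coeff p n) (coeff q n)) (sym (coeff-+ q p n)))

  +P-assoc : ∀ p q r → (p +P q) +P r ≋ p +P (q +P r)
  +P-assoc p q r = mk λ n → begin
    coeff ((p +P q) +P r) n                   ≡⟨ coeff-+ (p +P q) r n ⟩
    coeff (p +P q) n ℤ.+ coeff r n            ≡⟨ cong (ℤ._+ coeff r n) (coeff-+ p q n) ⟩
    coeff p n ℤ.+ coeff q n ℤ.+ coeff r n     ≡⟨ ℤP.+-assoc (coeff p n) (coeff q n) (coeff r n) ⟩
    coeff p n ℤ.+ (coeff q n ℤ.+ coeff r n)   ≡⟨ cong (ℤ._+_ (coeff p n)) (coeff-+ q r n) ⟨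
    coeff p n ℤ.+ coeff (q +P r) n            ≡⟨ coeff-+ p (q +P r) n ⟨
    coeff (p +P (q +P r)) n                   ∎
    where open ≡-Reasoning

  +P-identityʳ : ∀ p → p +P [] ≋ p
  +P-identityʳ p = mk λ n → trans (coeff-+ p [] n) (ℤP.+-identityʳ (coeff p n))

  -P-inverseʳ : ∀ p → p +P -P p ≋ []
  -P-inverseʳ p = mk λ n →
    trans (coeff-+ p (-P p) n) (trans (cong (ℤ._+_ (coeff p n)) (coeff-neg p n)) (ℤP.+-inverseʳ (coeff p n)))

  *P-zeroʳ : ∀ p → p *P [] ≋ []
  *P-zeroʳ []      = ≋-refl
  *P-zeroʳ (a ∷ p) = mk λ n → trans (coeff-* a p [] n) (vanish n)
    where
    vanish : ∀ n → a ℤ.* + 0 ℤ.+ coeff (+ 0 ∷ (p *P [])) n ≡ + 0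
    vanish zero    = trans (ℤP.+-identityʳ _) (ℤP.*-zeroʳ a)
    vanish (suc n) = cong₂ ℤ._+_ (ℤP.*-zeroʳ a) (at (*P-zeroʳ p) n)

  *P-consʳ : ∀ p b q → p *P (b ∷ q) ≋ (b ·P p) +P (+ 0 ∷ (p *P q))
  *P-consʳ []      b q = mk λ { zero → refl ; (suc n) → refl }
  *P-consʳ (a ∷ p) b q = mk coefficient
    where
    open ≡-Reasoning
    swap : ∀ a qn b pn s → a ℤ.* qn ℤ.+ (b ℤ.* pn ℤ.+ s) ≡ b ℤ.* pn ℤ.+ (a ℤ.* qn ℤ.+ s)
    swap = solve 5 (λ a qn b pn s → a :* qn :+ (b :* pn :+ s) := b :* pn :+ (a :* qn :+ s)) refl
    rhs : ∀ n → coeff ((b ·P (a ∷ p)) +P (+ 0 ∷ ((a ∷ p) *P q))) n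
              ≡ coeff (b ·P (a ∷ p)) n ℤ.+ coeff (+ 0 ∷ ((a ∷ p) *P q)) n
    rhs = coeff-+ (b ·P (a ∷ p)) (+ 0 ∷ ((a ∷ p) *P q))
    coefficient : ∀ n → coeff ((a ∷ p) *P (b ∷ q)) n ≡ coeff ((b ·P (a ∷ p)) +P (+ 0 ∷ ((a ∷ p) *P q))) n
    coefficient zero = begin
      coeff ((a ∷ p) *P (b ∷ q)) zero   ≡⟨ trans (coeff-* a p (b ∷ q) zero) (ℤP.+-identityʳ _) ⟩
      a ℤ.* b                           ≡⟨ ℤP.*-comm a b ⟩
      b ℤ.* a                           ≡⟨ ℤP.+-identityʳ _ ⟨
      b ℤ.* a ℤ.+ + 0                   ≡⟨ rhs zero ⟨
      coeff ((b ·P (a ∷ p)) +P (+ 0 ∷ ((a ∷ p) *P q))) zero ∎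
    coefficient (suc n) = begin
      coeff ((a ∷ p) *P (b ∷ q)) (suc n)
        ≡⟨ coeff-* a p (b ∷ q) (suc n) ⟩
      a ℤ.* coeff q n ℤ.+ coeff (p *P (b ∷ q)) n
        ≡⟨ cong (ℤ._+_ (a ℤ.* coeff q n)) (trans (at (*P-consʳ p b q) n) (trans (coeff-+ (b ·P p) _ n) (cong (ℤ._+ coeff (+ 0 ∷ (p *P q)) n) (coeff-· b p n)))) ⟩
      a ℤ.* coeff q n ℤ.+ (b ℤ.* coeff p n ℤ.+ coeff (+ 0 ∷ (p *P q)) n)
        ≡⟨ swap a (coeff q n) b (coeff p n) (coeff (+ 0 ∷ (p *P q)) n) ⟩
      b ℤ.* coeff p n ℤ.+ (a ℤ.* coeff q n ℤ.+ coeff (+ 0 ∷ (p *P q)) n)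
        ≡⟨ cong₂ ℤ._+_ (coeff-· b p n) (coeff-* a p q n) ⟨
      coeff (b ·P (a ∷ p)) (suc n) ℤ.+ coeff ((a ∷ p) *P q) n
        ≡⟨ rhs (suc n) ⟨
      coeff ((b ·P (a ∷ p)) +P (+ 0 ∷ ((a ∷ p) *P q))) (suc n) ∎

  *P-comm : ∀ p q → p *P q ≋ q *P p
  *P-comm []      q = ≋-sym (*P-zeroʳ q)
  *P-comm (a ∷ p) q =
    ≋-sym (≋-trans (*P-consʳ q a p) (+P-cong (≋-refl {a ·P q}) (∷-cong refl (*P-comm q p))))

  *P-distribˡ : ∀ p q r → p *P (q +P r) ≋ p *P q +P p *P r
  *P-distribˡ []      q r = ≋-refl
  *P-distribˡ (a ∷ p) q r = mk coefficient
    where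
    open ≡-Reasoning
    regroup : ∀ a x y u v → a ℤ.* (x ℤ.+ y) ℤ.+ (u ℤ.+ v) ≡ (a ℤ.* x ℤ.+ u) ℤ.+ (a ℤ.* y ℤ.+ v)
    regroup = solve 5 (λ a x y u v → a :* (x :+ y) :+ (u :+ v) := (a :* x :+ u) :+ (a :* y :+ v)) refl
    tails : ∀ n → coeff (+ 0 ∷ (p *P (q +P r))) n ≡ coeff (+ 0 ∷ (p *P q)) n ℤ.+ coeff (+ 0 ∷ (p *P r)) n
    tails zero    = refl
    tails (suc n) = trans (at (*P-distribˡ p q r) n) (coeff-+ (p *P q) (p *P r) n)
    coefficient : ∀ n → coeff ((a ∷ p) *P (q +P r)) n ≡ coeff ((a ∷ p) *P q +P (a ∷ p) *P r) n
    coefficient n = begin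
      coeff ((a ∷ p) *P (q +P r)) n
        ≡⟨ coeff-* a p (q +P r) n ⟩
      a ℤ.* coeff (q +P r) n ℤ.+ coeff (+ 0 ∷ (p *P (q +P r))) n
        ≡⟨ cong₂ ℤ._+_ (cong (a ℤ.*_) (coeff-+ q r n)) (tails n) ⟩
      a ℤ.* (coeff q n ℤ.+ coeff r n) ℤ.+ (coeff (+ 0 ∷ (p *P q)) n ℤ.+ coeff (+ 0 ∷ (p *P r)) n)
        ≡⟨ regroup a (coeff q n) (coeff r n) _ _ ⟩
      (a ℤ.* coeff q n ℤ.+ coeff (+ 0 ∷ (p *P q)) n) ℤ.+ (a ℤ.* coeff r n ℤ.+ coeff (+ 0 ∷ (p *P r)) n)
        ≡⟨ cong₂ ℤ._+_ (coeff-* a p q n) (coeff-* a p r n) ⟨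
      coeff ((a ∷ p) *P q) n ℤ.+ coeff ((a ∷ p) *P r) n
        ≡⟨ coeff-+ ((a ∷ p) *P q) ((a ∷ p) *P r) n ⟨
      coeff ((a ∷ p) *P q +P (a ∷ p) *P r) n ∎

  *P-distribʳ : ∀ p q r → (q +P r) *P p ≋ q *P p +P r *P p
  *P-distribʳ p q r =
    ≋-trans (*P-comm (q +P r) p) (≋-trans (*P-distribˡ p q r) (+P-cong (*P-comm p q) (*P-comm p r)))

  ·P-*P : ∀ c q r → (c ·P q) *P r ≋ c ·P (q *P r)
  ·P-*P c []      r = ≋-refl
  ·P-*P c (a ∷ q) r = mk coefficient
    where
    open ≡-Reasoning
    factor : ∀ c a x y → c ℤ.* a ℤ.* x ℤ.+ c ℤ.* y ≡ c ℤ.* (a ℤ.* x ℤ.+ y)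
    factor = solve 4 (λ c a x y → c :* a :* x :+ c :* y := c :* (a :* x :+ y)) refl
    tails : ∀ n → coeff (+ 0 ∷ ((c ·P q) *P r)) n ≡ c ℤ.* coeff (+ 0 ∷ (q *P r)) n
    tails zero    = sym (ℤP.*-zeroʳ c)
    tails (suc n) = trans (at (·P-*P c q r) n) (coeff-· c (q *P r) n)
    coefficient : ∀ n → coeff ((c ·P (a ∷ q)) *P r) n ≡ coeff (c ·P ((a ∷ q) *P r)) n
    coefficient n = begin
      coeff ((c ·P (a ∷ q)) *P r) n
        ≡⟨ coeff-* (c ℤ.* a) (c ·P q) r n ⟩
      c ℤ.* a ℤ.* coeff r n ℤ.+ coeff (+ 0 ∷ ((c ·P q) *P r)) n
        ≡⟨ cong (ℤ._+_ (c ℤ.* a ℤ.* coeff r n)) (tails n) ⟩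
      c ℤ.* a ℤ.* coeff r n ℤ.+ c ℤ.* coeff (+ 0 ∷ (q *P r)) n
        ≡⟨ factor c a (coeff r n) _ ⟩
      c ℤ.* (a ℤ.* coeff r n ℤ.+ coeff (+ 0 ∷ (q *P r)) n)
        ≡⟨ cong (c ℤ.*_) (coeff-* a q r n) ⟨
      c ℤ.* coeff ((a ∷ q) *P r) n
        ≡⟨ coeff-· c ((a ∷ q) *P r) n ⟨
      coeff (c ·P ((a ∷ q) *P r)) n ∎

  *P-assoc : ∀ p q r → (p *P q) *P r ≋ p *P (q *P r)
  *P-assoc []      q r = ≋-refl
  *P-assoc (a ∷ p) q r =
    ≋-trans (*P-distribʳ r (a ·P q) _)
            (+P-cong (·P-*P a q r) (≋-trans (0∷-* (p *P q) r) (∷-cong refl (*P-assoc p q r))))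

  *P-identityˡ : ∀ p → oneP *P p ≋ p
  *P-identityˡ p = mk λ n → trans (coeff-* (+ 1) [] p n) (trans (cong₂ ℤ._+_ (ℤP.*-identityˡ (coeff p n)) (vanish n)) (ℤP.+-identityʳ _))
    where
    vanish : ∀ n → coeff (+ 0 ∷ ([] *P p)) n ≡ + 0
    vanish zero    = refl
    vanish (suc n) = refl

  polyRing : CommutativeRing 0ℓ 0ℓ
  polyRing = record
    { Carrier = Poly ; _≈_ = _≋_ ; _+_ = _+P_ ; _*_ = _*P_ ; -_ = -P_ ; 0# = [] ; 1# = oneP
    ; isCommutativeRing = record
      { isRing = record
        { +-isAbelianGroup = record
          { isGroup = record
            { isMonoid = record
              { isSemigroup = record
                { isMagma = record
                  { isEquivalence = record { refl = ≋-refl ; sym = ≋-sym ; trans = ≋-trans }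
                  ; ∙-cong = +P-cong }
                ; assoc = +P-assoc }
              ; identity = (λ p → ≋-refl) , +P-identityʳ }
            ; inverse = (λ p → ≋-trans (+P-comm _ p) (-P-inverseʳ p)) , -P-inverseʳ
            ; ⁻¹-cong = -P-cong }
          ; comm = +P-comm }
        ; *-cong = *P-cong
        ; *-assoc = *P-assoc
        ; *-identity = *P-identityˡ , (λ p → ≋-trans (*P-comm p oneP) (*P-identityˡ p))
        ; distrib = *P-distribˡ , *P-distribʳ }
      ; *-comm = *P-comm } }

module PolynomialDomain where
  open Polynomials

  ℤ-rawRing : RawRing 0ℓ 0ℓ
  ℤ-rawRing = CommutativeRing.rawRing ℤP.+-*-commutativeRing

  module IntegerSolver (R : CommutativeRing 0ℓ 0ℓ)
                       (hom : ℤ-rawRing -Raw-AlmostCommutative⟶ fromCommutativeRing R) where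
    open CommutativeRing R using (_≈_) renaming (refl to ≈-refl)
    open _-Raw-AlmostCommutative⟶_ hom using (⟦_⟧)
    open import Data.Maybe using (Maybe; just; nothing)

    coefficients≟ : ∀ a b → Maybe (⟦ a ⟧ ≈ ⟦ b ⟧)
    coefficients≟ a b with a ℤP.≟ b
    ... | yes refl = just ≈-refl
    ... | no _     = nothing

    open import Algebra.Solver.Ring ℤ-rawRing (fromCommutativeRing R) hom coefficients≟ public

  ιP : ℤ → Poly
  ιP (+ zero) = []
  ιP c        = c ∷ []

  ιP-≋ : ∀ c → ιP c ≋ c ∷ []
  ιP-≋ (+ zero)    = mk λ { zero → refl ; (suc n) → refl }
  ιP-≋ (+ (suc n)) = ≋-refl
  ιP-≋ -[1+ n ]    = ≋-refl

  polyHom : ℤ-rawRing -Raw-AlmostCommutative⟶ fromCommutativeRing polyRing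
  polyHom = record
    { ⟦_⟧    = ιP
    ; +-homo = λ a b → ≋-trans (ιP-≋ (a ℤ.+ b)) (≋-sym (+P-cong (ιP-≋ a) (ιP-≋ b)))
    ; *-homo = λ a b → ≋-trans (ιP-≋ (a ℤ.* b))
                 (≋-trans (∷-cong (sym (ℤP.+-identityʳ _)) ≋-refl) (≋-sym (*P-cong (ιP-≋ a) (ιP-≋ b))))
    ; -‿homo = λ a → ≋-trans (ιP-≋ (ℤ.- a))
                 (≋-trans (∷-cong (sym (ℤP.-1*i≡-i a)) ≋-refl) (≋-sym (-P-cong (ιP-≋ a))))
    ; 0-homo = ≋-refl
    ; 1-homo = ≋-refl }

  module PS = IntegerSolver polyRing polyHom
  open PS using (_:+_; _:*_; :-_; _:=_)

  -- ℤ[t] is an integral domain.  The proof peels off factors of t from the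
  -- right operand until its constant term is nonzero, then compares lowest
  -- coefficients.
  NZ : Poly → Set
  NZ p = ¬ (p ≋ [])

  private
    domain-const : ∀ p b q → ¬ (b ≡ + 0) → p *P (b ∷ q) ≋ [] → p ≋ []
    domain-const []      b q b≢0 e = ≋-refl
    domain-const (a ∷ p) b q b≢0 e = mk λ { zero → a≡0 ; (suc n) → at (domain-const p b q b≢0 rest) n }
      where
      a≡0 : a ≡ + 0
      a≡0 with ℤP.i*j≡0⇒i≡0∨j≡0 a (trans (sym (trans (coeff-* a p (b ∷ q) zero) (ℤP.+-identityʳ _))) (at e zero))
      ... | inj₁ a≡0 = a≡0
      ... | inj₂ b≡0 = ⊥-elim (b≢0 b≡0)
      rest : p *P (b ∷ q) ≋ []
      rest = tail-zero (≋-trans (≋-sym (0∷-* p (b ∷ q)))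
                       (≋-trans (*P-congˡ (b ∷ q) (∷-cong (sym a≡0) (≋-refl {p}))) e))

  domain : ∀ p q → p *P q ≋ [] → NZ q → p ≋ []
  domain p []      e q≢0 = ⊥-elim (q≢0 ≋-refl)
  domain p (b ∷ q) e q≢0 with b ℤP.≟ + 0
  ... | no b≢0   = domain-const p b q b≢0 e
  ... | yes refl = domain p q (tail-zero (≋-trans (≋-sym shifted) e)) (λ q≋0 → q≢0 (shift-zero q≋0))
    where
    shifted : p *P (+ 0 ∷ q) ≋ + 0 ∷ (p *P q)
    shifted = ≋-trans (*P-consʳ p (+ 0) q) (+P-cong (·P-zero p) ≋-refl)

  NZ-* : ∀ {p q} → NZ p → NZ q → NZ (p *P q)
  NZ-* {p} {q} p≢0 q≢0 e = p≢0 (domain p q e q≢0)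

  NZ-coeff : ∀ p n → ¬ (coeff p n ≡ + 0) → NZ p
  NZ-coeff p n c≢0 e = c≢0 (at e n)

  NZ-oneP : NZ oneP
  NZ-oneP = NZ-coeff oneP 0 (λ ())

  cancel : ∀ p q d → NZ d → p *P d ≋ q *P d → p ≋ q
  cancel p q d d≢0 e = ≋-trans (≋-sym (restore p q)) (+P-cong p-q≋0 ≋-refl)
    where
    restore : ∀ p q → (p +P -P q) +P q ≋ p
    restore = PS.solve 2 (λ p q → (p :+ :- q) :+ q := p) ≋-refl
    p-q≋0 : p +P -P q ≋ []
    p-q≋0 = domain _ d (≋-trans (PS.solve 3 (λ p q d → (p :+ :- q) :* d := p :* d :+ :- (q :* d)) ≋-refl p q d)
                                (≋-trans (+P-cong e ≋-refl) (-P-inverseʳ (q *P d)))) d≢0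

  ≋[]⇒IsZeroP : ∀ {r} → r ≋ [] → IsZeroP r
  ≋[]⇒IsZeroP {[]}    e = []
  ≋[]⇒IsZeroP {a ∷ r} e = at e zero ∷ ≋[]⇒IsZeroP (tail-zero e)

module Fractions where
  open Polynomials
  open PolynomialDomain

  open PS using (_:+_; _:*_; :-_; _:=_; con)

  -- These form
  -- the field ℚ(t) in which all computations take place; `raw` forgets the
  -- nonvanishing proof and lands in the statement's representation.
  record F : Set where
    constructor fr
    field
      num den : Poly
      nz      : NZ den
  open F public

  raw : F → RatFun
  raw x = (num x , den x)

  infix 4 _≈F_
  record _≈F_ (x y : F) : Set where
    constructor eqF
    field cross : num x *P den y ≋ num y *P den x
  open _≈F_ public

  ≈F⇒≈R : ∀ x y → x ≈F y → raw x ≈R raw y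
  ≈F⇒≈R x y (eqF e) = ≋[]⇒IsZeroP (≋-trans (+P-cong e ≋-refl) (-P-inverseʳ (num y *P den x)))

  ιF : ℤ → F
  ιF c = fr (ιP c) oneP NZ-oneP

  0F 1F : F
  0F = ιF (+ 0)
  1F = ιF (+ 1)

  infixl 6 _+F_ _-F_
  infixl 7 _*F_
  infix  8 -F_

  -- The operations are opaque so that the ring solver sees them as atoms;
  -- everything needed about them is recorded in this block.
  opaque
    _+F_ _*F_ _-F_ : F → F → F
    x +F y = fr (num x *P den y +P num y *P den x) (den x *P den y) (NZ-* (nz x) (nz y))
    x *F y = fr (num x *P num y) (den x *P den y) (NZ-* (nz x) (nz y))
    x -F y = fr (num x *P den y +P -P (num y *P den x)) (den x *P den y) (NZ-* (nz x) (nz y))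

    -F_ : F → F
    -F x = fr (-P num x) (den x) (nz x)

    invF : (x : F) → NZ (num x) → F
    invF x x≢0 = fr (den x) (num x) x≢0

    raw-* : ∀ x y → raw (x *F y) ≡ raw x *R raw y
    raw-* x y = refl
    raw-- : ∀ x y → raw (x -F y) ≡ raw x -R raw y
    raw-- x y = refl
    raw-+ : ∀ x y → raw (x +F y) ≡ raw x +R raw y
    raw-+ x y = refl
    raw-/ : ∀ x y y≢0 → raw (x *F invF y y≢0) ≡ raw x /R raw y
    raw-/ x y y≢0 = refl

    num-* : ∀ x y → num (x *F y) ≡ num x *P num y
    num-* x y = refl
    num-- : ∀ x y → num (x -F y) ≡ num x *P den y +P -P (num y *P den x)
    num-- x y = refl
    *F-fr : ∀ a b c d b≢0 d≢0 → fr a b b≢0 *F fr c d d≢0 ≈F fr (a *P c) (b *P d) (NZ-* b≢0 d≢0)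
    *F-fr a b c d b≢0 d≢0 = eqF ≋-refl

    ≈F-refl : ∀ {x} → x ≈F x
    ≈F-refl = eqF ≋-refl

    ≈F-sym : ∀ {x y} → x ≈F y → y ≈F x
    ≈F-sym (eqF e) = eqF (≋-sym e)

    ≈F-trans : ∀ {x y z} → x ≈F y → y ≈F z → x ≈F z
    ≈F-trans {fr a b _} {fr c d d≢0} {fr e f _} (eqF p) (eqF q) = eqF (cancel (a *P f) (e *P b) d d≢0
      (≋-trans (PS.solve 3 (λ a f d → (a :* f) :* d := (a :* d) :* f) ≋-refl a f d)
      (≋-trans (*P-congˡ f p)
      (≋-trans (PS.solve 3 (λ c b f → (c :* b) :* f := (c :* f) :* b) ≋-refl c b f)
      (≋-trans (*P-congˡ b q)
      (PS.solve 3 (λ e d b → (e :* d) :* b := (e :* b) :* d) ≋-refl e d b))))))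

    +F-cong : ∀ {x x' y y'} → x ≈F x' → y ≈F y' → x +F y ≈F x' +F y'
    +F-cong {fr a b _} {fr a' b' _} {fr c d _} {fr c' d' _} (eqF p) (eqF q) = eqF (
      ≋-trans (PS.solve 6 (λ a b c d b' d' → (a :* d :+ c :* b) :* (b' :* d') := (a :* b') :* (d :* d') :+ (c :* d') :* (b :* b')) ≋-refl a b c d b' d')
      (≋-trans (+P-cong (*P-congˡ (d *P d') p) (*P-congˡ (b *P b') q))
      (PS.solve 6 (λ a' b' c' d' b d → (a' :* b) :* (d :* d') :+ (c' :* d) :* (b :* b') := (a' :* d' :+ c' :* b') :* (b :* d)) ≋-refl a' b' c' d' b d)))

    *F-cong : ∀ {x x' y y'} → x ≈F x' → y ≈F y' → x *F y ≈F x' *F y'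
    *F-cong {fr a b _} {fr a' b' _} {fr c d _} {fr c' d' _} (eqF p) (eqF q) = eqF (
      ≋-trans (PS.solve 6 (λ a b c d b' d' → (a :* c) :* (b' :* d') := (a :* b') :* (c :* d')) ≋-refl a b c d b' d')
      (≋-trans (*P-cong p q)
      (PS.solve 6 (λ a' b' c' d' b d → (a' :* b) :* (c' :* d) := (a' :* c') :* (b :* d)) ≋-refl a' b' c' d' b d)))

    -F-cong : ∀ {x x'} → x ≈F x' → -F x ≈F -F x'
    -F-cong {fr a b _} {fr a' b' _} (eqF p) = eqF (
      ≋-trans (PS.solve 2 (λ a b' → (:- a) :* b' := :- (a :* b')) ≋-refl a b')
      (≋-trans (-P-cong p) (PS.solve 2 (λ a' b → :- (a' :* b) := (:- a') :* b) ≋-refl a' b)))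

    +F-assoc : ∀ x y z → (x +F y) +F z ≈F x +F (y +F z)
    +F-assoc (fr a b _) (fr c d _) (fr e f _) = eqF (PS.solve 6 (λ a b c d e f → ((a :* d :+ c :* b) :* f :+ e :* (b :* d)) :* (b :* (d :* f))
          := (a :* (d :* f) :+ (c :* f :+ e :* d) :* b) :* ((b :* d) :* f))
          ≋-refl a b c d e f)
    +F-idˡ : ∀ x → 0F +F x ≈F x
    +F-idˡ (fr a b _) = eqF (PS.solve 2 (λ a b → (con (+ 0) :* b :+ a :* con (+ 1)) :* b := a :* (con (+ 1) :* b)) ≋-refl a b)
    +F-idʳ : ∀ x → x +F 0F ≈F x
    +F-idʳ (fr a b _) = eqF (PS.solve 2 (λ a b → (a :* con (+ 1) :+ con (+ 0) :* b) :* b := a :* (b :* con (+ 1))) ≋-refl a b)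
    +F-invˡ : ∀ x → (-F x) +F x ≈F 0F
    +F-invˡ (fr a b _) = eqF (PS.solve 2 (λ a b → ((:- a) :* b :+ a :* b) :* con (+ 1) := con (+ 0) :* (b :* b)) ≋-refl a b)
    +F-invʳ : ∀ x → x +F (-F x) ≈F 0F
    +F-invʳ (fr a b _) = eqF (PS.solve 2 (λ a b → (a :* b :+ (:- a) :* b) :* con (+ 1) := con (+ 0) :* (b :* b)) ≋-refl a b)
    +F-comm : ∀ x y → x +F y ≈F y +F x
    +F-comm (fr a b _) (fr c d _) = eqF (PS.solve 4 (λ a b c d → (a :* d :+ c :* b) :* (d :* b) := (c :* b :+ a :* d) :* (b :* d)) ≋-refl a b c d)
    *F-assoc : ∀ x y z → (x *F y) *F z ≈F x *F (y *F z)
    *F-assoc (fr a b _) (fr c d _) (fr e f _) = eqF (PS.solve 6 (λ a b c d e f → ((a :* c) :* e) :* (b :* (d :* f)) := (a :* (c :* e)) :* ((b :* d) :* f)) ≋-refl a b c d e f)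
    *F-idˡ : ∀ x → 1F *F x ≈F x
    *F-idˡ (fr a b _) = eqF (PS.solve 2 (λ a b → (con (+ 1) :* a) :* b := a :* (con (+ 1) :* b)) ≋-refl a b)
    *F-idʳ : ∀ x → x *F 1F ≈F x
    *F-idʳ (fr a b _) = eqF (PS.solve 2 (λ a b → (a :* con (+ 1)) :* b := a :* (b :* con (+ 1))) ≋-refl a b)
    *F-distribˡ : ∀ x y z → x *F (y +F z) ≈F x *F y +F x *F z
    *F-distribˡ (fr a b _) (fr c d _) (fr e f _) = eqF (PS.solve 6 (λ a b c d e f → (a :* (c :* f :+ e :* d)) :* ((b :* d) :* (b :* f))
          := ((a :* c) :* (b :* f) :+ (a :* e) :* (b :* d)) :* (b :* (d :* f)))
          ≋-refl a b c d e f)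
    *F-distribʳ : ∀ x y z → (y +F z) *F x ≈F y *F x +F z *F x
    *F-distribʳ (fr a b _) (fr c d _) (fr e f _) = eqF (PS.solve 6 (λ a b c d e f → ((c :* f :+ e :* d) :* a) :* ((d :* b) :* (f :* b))
          := ((c :* a) :* (f :* b) :+ (e :* a) :* (d :* b)) :* ((d :* f) :* b))
          ≋-refl a b c d e f)
    *F-comm : ∀ x y → x *F y ≈F y *F x
    *F-comm (fr a b _) (fr c d _) = eqF (PS.solve 4 (λ a b c d → (a :* c) :* (d :* b) := (c :* a) :* (b :* d)) ≋-refl a b c d)

    -F≈ : ∀ x y → x -F y ≈F x +F -F y
    -F≈ (fr a b _) (fr c d _) = eqF (PS.solve 4 (λ a b c d → (a :* d :+ :- (c :* b)) :* (b :* d) := (a :* d :+ (:- c) :* b) :* (b :* d)) ≋-refl a b c d)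

    invF-inverse : ∀ x (x≢0 : NZ (num x)) → x *F invF x x≢0 ≈F 1F
    invF-inverse (fr a b _) x≢0 = eqF (PS.solve 2 (λ a b → (a :* b) :* con (+ 1) := con (+ 1) :* (b :* a)) ≋-refl a b)

    invF-* : ∀ x y xy≢0 x≢0 y≢0 → invF (x *F y) xy≢0 ≈F invF x x≢0 *F invF y y≢0
    invF-* x y _ _ _ = eqF ≋-refl

    invF-cong : ∀ x y x≢0 y≢0 → x ≈F y → invF x x≢0 ≈F invF y y≢0
    invF-cong (fr a b _) (fr c d _) _ _ (eqF e) = eqF (≋-trans (PS.solve 2 (λ b c → b :* c := c :* b) ≋-refl b c) (≋-trans (≋-sym e) (PS.solve 2 (λ a d → a :* d := d :* a) ≋-refl a d)))

    ιF-+ : ∀ a b → ιF (a ℤ.+ b) ≈F ιF a +F ιF b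
    ιF-+ a b = eqF (≋-trans (*P-congˡ (oneP *P oneP) (+-homo a b)) (PS.solve 2 (λ x y → (x :+ y) :* (con (+ 1) :* con (+ 1)) := (x :* con (+ 1) :+ y :* con (+ 1)) :* con (+ 1)) ≋-refl (ιP a) (ιP b)))
      where open _-Raw-AlmostCommutative⟶_ polyHom
    ιF-* : ∀ a b → ιF (a ℤ.* b) ≈F ιF a *F ιF b
    ιF-* a b = eqF (≋-trans (*P-congˡ (oneP *P oneP) (*-homo a b)) (PS.solve 2 (λ x y → (x :* y) :* (con (+ 1) :* con (+ 1)) := (x :* y) :* con (+ 1)) ≋-refl (ιP a) (ιP b)))
      where open _-Raw-AlmostCommutative⟶_ polyHom
    ιF-neg : ∀ a → ιF (ℤ.- a) ≈F -F ιF a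
    ιF-neg a = eqF (*P-congˡ oneP (-‿homo a))
      where open _-Raw-AlmostCommutative⟶_ polyHom

  fRing : CommutativeRing 0ℓ 0ℓ
  fRing = record
    { Carrier = F ; _≈_ = _≈F_ ; _+_ = _+F_ ; _*_ = _*F_ ; -_ = -F_ ; 0# = 0F ; 1# = 1F
    ; isCommutativeRing = record
      { isRing = record
        { +-isAbelianGroup = record
          { isGroup = record
            { isMonoid = record
              { isSemigroup = record
                { isMagma = record
                  { isEquivalence = record { refl = λ {x} → ≈F-refl {x} ; sym = λ {x} {y} → ≈F-sym {x} {y}
                                           ; trans = λ {x} {y} {z} → ≈F-trans {x} {y} {z} }
                  ; ∙-cong = λ {x} {x'} {y} {y'} → +F-cong {x} {x'} {y} {y'} }
                ; assoc = +F-assoc }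
              ; identity = +F-idˡ , +F-idʳ }
            ; inverse = +F-invˡ , +F-invʳ
            ; ⁻¹-cong = λ {x} {x'} → -F-cong {x} {x'} }
          ; comm = +F-comm }
        ; *-cong = λ {x} {x'} {y} {y'} → *F-cong {x} {x'} {y} {y'}
        ; *-assoc = *F-assoc
        ; *-identity = *F-idˡ , *F-idʳ
        ; distrib = *F-distribˡ , *F-distribʳ }
      ; *-comm = *F-comm } }

  fHom : ℤ-rawRing -Raw-AlmostCommutative⟶ fromCommutativeRing fRing
  fHom = record
    { ⟦_⟧ = ιF ; +-homo = ιF-+ ; *-homo = ιF-* ; -‿homo = ιF-neg ; 0-homo = ≈F-refl ; 1-homo = ≈F-refl }

  module FS = IntegerSolver fRing fHom
  module FR = CommutativeRing fRing

module PowersAndSums where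
  open Polynomials
  open PolynomialDomain
  open Fractions
  open import Relation.Binary.Reasoning.Setoid FR.setoid public

  open FS using (solve; _:+_; _:*_; :-_; _:=_; con)

  infixl 7 _⟨*⟩_
  infixl 6 _⟨+⟩_

  _⟨*⟩_ : ∀ {x y u v} → x ≈F y → u ≈F v → x *F u ≈F y *F v
  _⟨*⟩_ = FR.*-cong

  _⟨+⟩_ : ∀ {x y u v} → x ≈F y → u ≈F v → x +F u ≈F y +F v
  _⟨+⟩_ = FR.+-cong

  ≈F-reflexive : ∀ {x y} → x ≡ y → x ≈F y
  ≈F-reflexive {x} refl = FR.refl {x}

  NZE : F → Set
  NZE x = NZ (num x)

  NZE-≈ : ∀ {x y} → x ≈F y → NZE y → NZE x
  NZE-≈ {fr a b b≢0} {fr c d _} (eqF e) c≢0 a≋0 = c≢0 (domain c b (≋-trans (≋-sym e) (*P-zeroˡ d a≋0)) b≢0)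

  NZE-* : ∀ {x y} → NZE x → NZE y → NZE (x *F y)
  NZE-* {x} {y} x≢0 y≢0 rewrite num-* x y = NZ-* x≢0 y≢0

  cancelF : ∀ d x y → NZE d → d *F x ≈F d *F y → x ≈F y
  cancelF d x y d≢0 e = begin
    x                 ≈⟨ solve 1 (λ x → x := con (+ 1) :* x) FR.refl x ⟩
    1F *F x           ≈⟨ FR.sym (invF-inverse d d≢0) ⟨*⟩ FR.refl ⟩
    (d *F d⁻¹) *F x   ≈⟨ solve 3 (λ i d x → (d :* i) :* x := i :* (d :* x)) FR.refl d⁻¹ d x ⟩
    d⁻¹ *F (d *F x)   ≈⟨ FR.refl ⟨*⟩ e ⟩
    d⁻¹ *F (d *F y)   ≈⟨ solve 3 (λ i d x → i :* (d :* x) := (d :* i) :* x) FR.refl d⁻¹ d y ⟩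
    (d *F d⁻¹) *F y   ≈⟨ invF-inverse d d≢0 ⟨*⟩ FR.refl ⟩
    1F *F y           ≈⟨ solve 1 (λ x → con (+ 1) :* x := x) FR.refl y ⟩
    y                 ∎
    where d⁻¹ = invF d d≢0

  monoP-+ : ∀ a b → monoP (a ℕ.+ b) ≋ monoP a *P monoP b
  monoP-+ zero    b = ≋-sym (*P-identityˡ (monoP b))
  monoP-+ (suc a) b = ≋-trans (∷-cong refl (monoP-+ a b)) (≋-sym (0∷-* (monoP a) (monoP b)))

  NZ-monoP : ∀ n → NZ (monoP n)
  NZ-monoP n = NZ-coeff (monoP n) n (λ e → one≢zero (trans (sym (leading n)) e))
    where
    leading : ∀ n → coeff (monoP n) n ≡ + 1
    leading zero    = refl
    leading (suc n) = leading n
    one≢zero : ¬ (+ 1 ≡ + 0)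
    one≢zero ()

  differences⇒sums : ∀ a b c d → + a ℤ.- + b ≡ + c ℤ.- + d → a ℕ.+ d ≡ c ℕ.+ b
  differences⇒sums a b c d e = ℤP.+-injective
    (trans (zsolve 3 (λ a b d → a +' d =' (a -' b) +' (b +' d)) refl (+ a) (+ b) (+ d))
    (trans (cong (ℤ._+ (+ b ℤ.+ + d)) e)
           (zsolve 3 (λ c d b → (c -' d) +' (b +' d) =' c +' b) refl (+ c) (+ d) (+ b))))
    where open +-*-Solver using () renaming (solve to zsolve; _:+_ to _+'_; _:-_ to _-'_; _:=_ to _='_)

  sums⇒differences : ∀ a b c d → a ℕ.+ d ≡ c ℕ.+ b → + a ℤ.- + b ≡ + c ℤ.- + d
  sums⇒differences a b c d e =
    trans (zsolve 3 (λ a b d → a -' b =' (a +' d) -' (b +' d)) refl (+ a) (+ b) (+ d))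
    (trans (cong (λ z → z ℤ.- (+ b ℤ.+ + d)) (cong +_ e))
           (zsolve 3 (λ c b d → (c +' b) -' (b +' d) =' c -' d) refl (+ c) (+ b) (+ d)))
    where open +-*-Solver using () renaming (solve to zsolve; _:+_ to _+'_; _:-_ to _-'_; _:=_ to _='_)

  -- t^a / t^b for natural a, b, and the positive and negative parts of an
  -- integer; every integer power of t is of this form.
  private
    frm : ℕ → ℕ → F
    frm a b = fr (monoP a) (monoP b) (NZ-monoP b)

    frm-eq : ∀ a b c d → a ℕ.+ d ≡ c ℕ.+ b → frm a b ≈F frm c d
    frm-eq a b c d e = eqF (≋-trans (≋-sym (monoP-+ a d)) (≋-trans (≡⇒≋ (cong monoP e)) (monoP-+ c b)))

    frm-* : ∀ a b c d → frm a b *F frm c d ≈F frm (a ℕ.+ c) (b ℕ.+ d)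
    frm-* a b c d = FR.trans (*F-fr (monoP a) (monoP b) (monoP c) (monoP d) _ _)
                             (eqF (*P-cong (≋-sym (monoP-+ a c)) (monoP-+ b d)))

    pos neg : ℤ → ℕ
    pos (+ n)    = n
    pos -[1+ n ] = 0
    neg (+ n)    = 0
    neg -[1+ n ] = suc n

    open +-*-Solver using () renaming (solve to zsolve; _:+_ to _+'_; _:-_ to _-'_; _:=_ to _='_)

    split : ∀ z → z ≡ + pos z ℤ.- + neg z
    split (+ n)    = sym (ℤP.+-identityʳ (+ n))
    split -[1+ n ] = refl

  -- Integer powers of t, with the representation of the statement's `tpow`;
  -- opaque so that unification never looks inside them.
  opaque
    tpowF : ℤ → F
    tpowF (+ n)    = fr (monoP n) oneP NZ-oneP
    tpowF -[1+ n ] = fr oneP (monoP (suc n)) (NZ-monoP (suc n))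

    raw-tpow : ∀ z → raw (tpowF z) ≡ tpow z
    raw-tpow (+ n)    = refl
    raw-tpow -[1+ n ] = refl

    tpow-0 : tpowF (+ 0) ≈F 1F
    tpow-0 = FR.refl

    private
      tpow-frm : ∀ z → tpowF z ≈F frm (pos z) (neg z)
      tpow-frm (+ n)    = eqF ≋-refl
      tpow-frm -[1+ n ] = eqF ≋-refl

    tpow-+ : ∀ z w → tpowF (z ℤ.+ w) ≈F tpowF z *F tpowF w
    tpow-+ z w = begin
      tpowF (z ℤ.+ w)                              ≈⟨ tpow-frm (z ℤ.+ w) ⟩
      frm (pos (z ℤ.+ w)) (neg (z ℤ.+ w))          ≈⟨ frm-eq _ _ _ _ (differences⇒sums (pos (z ℤ.+ w)) (neg (z ℤ.+ w)) (pos z ℕ.+ pos w) (neg z ℕ.+ neg w) parts) ⟩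
      frm (pos z ℕ.+ pos w) (neg z ℕ.+ neg w)      ≈⟨ FR.sym (frm-* (pos z) (neg z) (pos w) (neg w)) ⟩
      frm (pos z) (neg z) *F frm (pos w) (neg w)   ≈⟨ FR.sym (tpow-frm z ⟨*⟩ tpow-frm w) ⟩
      tpowF z *F tpowF w                           ∎
      where
      parts : + pos (z ℤ.+ w) ℤ.- + neg (z ℤ.+ w) ≡ + (pos z ℕ.+ pos w) ℤ.- + (neg z ℕ.+ neg w)
      parts = trans (sym (split (z ℤ.+ w))) (trans (cong₂ ℤ._+_ (split z) (split w))
                (trans (zsolve 4 (λ a b c d → (a -' b) +' (c -' d) =' (a +' c) -' (b +' d)) refl (+ pos z) (+ neg z) (+ pos w) (+ neg w))
                       (cong₂ ℤ._-_ (ℤP.pos-+ (pos z) (pos w)) (ℤP.pos-+ (neg z) (neg w)))))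

  tpow-cong : ∀ {z w} → z ≡ w → tpowF z ≈F tpowF w
  tpow-cong refl = FR.refl

  ω : ℤ → F
  ω z = 1F -F tpowF z

  ω≈ : ∀ z → ω z ≈F 1F +F -F tpowF z
  ω≈ z = -F≈ 1F (tpowF z)

  -- 1 - t^z ≠ 0 for z ≠ 0: its numerator has constant term ±1.
  opaque
    unfolding tpowF
    ω-nonzero : ∀ z → ¬ (z ≡ + 0) → NZE (ω z)
    ω-nonzero (+ zero)  z≢0 = ⊥-elim (z≢0 refl)
    ω-nonzero (+ suc s) z≢0 rewrite num-- 1F (tpowF (+ suc s)) = NZ-coeff _ 0 (λ ())
    ω-nonzero -[1+ s ]  z≢0 rewrite num-- 1F (tpowF -[1+ s ]) = NZ-coeff _ 0 (λ ())

  ω-0 : ω (+ 0) ≈F 0F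
  ω-0 = FR.trans (ω≈ (+ 0)) (FR.trans (FR.refl ⟨+⟩ FR.-‿cong tpow-0) (FR.-‿inverseʳ 1F))

  sumF : ℕ → (ℕ → F) → F
  sumF zero    f = 0F
  sumF (suc n) f = sumF n f +F f n

  prodF : ℕ → (ℕ → F) → F
  prodF zero    f = 1F
  prodF (suc n) f = prodF n f *F f n

  raw-sum : ∀ N (f : ℕ → F) (g : ℕ → RatFun) → (∀ k → k < N → raw (f k) ≡ g k) → raw (sumF N f) ≡ sumR N g
  raw-sum zero    f g h = refl
  raw-sum (suc N) f g h = trans (raw-+ (sumF N f) (f N))
    (cong₂ _+R_ (raw-sum N f g (λ k k<N → h k (ℕP.m<n⇒m<1+n k<N))) (h N (ℕP.n<1+n N)))

  raw-prod : ∀ N (f : ℕ → F) (g : ℕ → RatFun) → (∀ k → k < N → raw (f k) ≡ g k) → raw (prodF N f) ≡ prodR N g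
  raw-prod zero    f g h = refl
  raw-prod (suc N) f g h = trans (raw-* (prodF N f) (f N))
    (cong₂ _*R_ (raw-prod N f g (λ k k<N → h k (ℕP.m<n⇒m<1+n k<N))) (h N (ℕP.n<1+n N)))

  NZE-prod : ∀ N (f : ℕ → F) → (∀ k → k < N → NZE (f k)) → NZE (prodF N f)
  NZE-prod zero    f h = NZ-oneP
  NZE-prod (suc N) f h = NZE-* {prodF N f} {f N} (NZE-prod N f (λ k k<N → h k (ℕP.m<n⇒m<1+n k<N))) (h N (ℕP.n<1+n N))

  sum-cong : ∀ N {f g : ℕ → F} → (∀ k → k < N → f k ≈F g k) → sumF N f ≈F sumF N g
  sum-cong zero    h = FR.refl
  sum-cong (suc N) h = sum-cong N (λ k k<N → h k (ℕP.m<n⇒m<1+n k<N)) ⟨+⟩ h N (ℕP.n<1+n N)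

  sum-+ : ∀ N (f g : ℕ → F) → sumF N (λ k → f k +F g k) ≈F sumF N f +F sumF N g
  sum-+ zero    f g = solve 0 (con (+ 0) := con (+ 0) :+ con (+ 0)) FR.refl
  sum-+ (suc N) f g = begin
    sumF N (λ k → f k +F g k) +F (f N +F g N)  ≈⟨ sum-+ N f g ⟨+⟩ FR.refl ⟩
    (sumF N f +F sumF N g) +F (f N +F g N)     ≈⟨ solve 4 (λ a b c d → (a :+ b) :+ (c :+ d) := (a :+ c) :+ (b :+ d)) FR.refl (sumF N f) (sumF N g) (f N) (g N) ⟩
    (sumF N f +F f N) +F (sumF N g +F g N)     ∎

  sum-*ˡ : ∀ N c (f : ℕ → F) → c *F sumF N f ≈F sumF N (λ k → c *F f k)
  sum-*ˡ zero    c f = solve 1 (λ c → c :* con (+ 0) := con (+ 0)) FR.refl c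
  sum-*ˡ (suc N) c f = begin
    c *F (sumF N f +F f N)          ≈⟨ FR.distribˡ c (sumF N f) (f N) ⟩
    c *F sumF N f +F c *F f N       ≈⟨ sum-*ˡ N c f ⟨+⟩ FR.refl ⟩
    sumF N (λ k → c *F f k) +F c *F f N ∎

  sum-zero : ∀ N (f : ℕ → F) → (∀ k → k < N → f k ≈F 0F) → sumF N f ≈F 0F
  sum-zero zero    f h = FR.refl
  sum-zero (suc N) f h = FR.trans (sum-zero N f (λ k k<N → h k (ℕP.m<n⇒m<1+n k<N)) ⟨+⟩ h N (ℕP.n<1+n N)) (FR.+-identityˡ 0F)

  sum-split : ∀ a b (f : ℕ → F) → sumF (a ℕ.+ b) f ≈F sumF a f +F sumF b (λ k → f (a ℕ.+ k))
  sum-split a zero    f = FR.trans (≈F-reflexive (cong (λ n → sumF n f) (ℕP.+-identityʳ a))) (FR.sym (FR.+-identityʳ _))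
  sum-split a (suc b) f = begin
    sumF (a ℕ.+ suc b) f                                       ≈⟨ ≈F-reflexive (cong (λ n → sumF n f) (ℕP.+-suc a b)) ⟩
    sumF (a ℕ.+ b) f +F f (a ℕ.+ b)                            ≈⟨ sum-split a b f ⟨+⟩ FR.refl ⟩
    (sumF a f +F sumF b (λ k → f (a ℕ.+ k))) +F f (a ℕ.+ b)    ≈⟨ FR.+-assoc (sumF a f) _ _ ⟩
    sumF a f +F (sumF b (λ k → f (a ℕ.+ k)) +F f (a ℕ.+ b))    ∎

  sum-extend : ∀ N M (f : ℕ → F) → (∀ k → N ≤ k → f k ≈F 0F) → N ≤ M → sumF M f ≈F sumF N f
  sum-extend N M f h N≤M = begin
    sumF M f                                          ≈⟨ ≈F-reflexive (cong (λ n → sumF n f) (sym (ℕP.m+[n∸m]≡n N≤M))) ⟩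
    sumF (N ℕ.+ (M ℕ.∸ N)) f                          ≈⟨ sum-split N (M ℕ.∸ N) f ⟩
    sumF N f +F sumF (M ℕ.∸ N) (λ k → f (N ℕ.+ k))    ≈⟨ FR.refl ⟨+⟩ sum-zero (M ℕ.∸ N) _ (λ k _ → h (N ℕ.+ k) (ℕP.m≤m+n N k)) ⟩
    sumF N f +F 0F                                    ≈⟨ FR.+-identityʳ _ ⟩
    sumF N f                                          ∎

  telescope : ∀ N (G : ℕ → F) → sumF N (λ k → G (suc k) +F -F G k) ≈F G N +F -F G 0
  telescope zero    G = FR.sym (FR.-‿inverseʳ (G 0))
  telescope (suc N) G = begin
    sumF N (λ k → G (suc k) +F -F G k) +F (G (suc N) +F -F G N)  ≈⟨ telescope N G ⟨+⟩ FR.refl ⟩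
    (G N +F -F G 0) +F (G (suc N) +F -F G N)                     ≈⟨ solve 3 (λ a b c → (a :+ :- b) :+ (c :+ :- a) := c :+ :- b) FR.refl (G N) (G 0) (G (suc N)) ⟩
    G (suc N) +F -F G 0                                          ∎

  sum-single : ∀ N k₀ (f : ℕ → F) → k₀ < N → (∀ k → k < N → ¬ (k ≡ k₀) → f k ≈F 0F) → sumF N f ≈F f k₀
  sum-single (suc N) k₀ f k₀<N h with k₀ ℕP.≟ N
  ... | yes refl = FR.trans (sum-zero N f (λ k k<N → h k (ℕP.m<n⇒m<1+n k<N) (λ e → ℕP.<-irrefl e k<N)) ⟨+⟩ FR.refl)
                            (FR.+-identityˡ (f N))
  ... | no k₀≢N  = FR.trans (sum-single N k₀ f (ℕP.≤∧≢⇒< (ℕP.≤-pred k₀<N) k₀≢N) (λ k k<N → h k (ℕP.m<n⇒m<1+n k<N))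
                              ⟨+⟩ h N (ℕP.n<1+n N) (λ e → k₀≢N (sym e)))
                            (FR.+-identityʳ (f k₀))

module Phi where
  open Polynomials
  open PolynomialDomain
  open Fractions
  open PowersAndSums

  open FS using (solve; _:*_; _:=_)

  -- φ_n = ∏_{r=1}^{n} (1 - t^r) and its reciprocal, extended to all integers
  -- by 1/φ_z = 0 for z < 0 (the usual convention 1/(t;t)_{-k} = 0), which
  -- lets every sum below run over a fixed range.
  φF : ℕ → F
  φF n = prodF n (λ r → ω (+ suc r))

  raw-φ : ∀ n → raw (φF n) ≡ φ n
  raw-φ n = raw-prod n _ _ (λ k _ → trans (raw-- 1F (tpowF (+ suc k))) (cong (oneR -R_) (raw-tpow (+ suc k))))

  φ-nonzero : ∀ n → NZE (φF n)
  φ-nonzero n = NZE-prod n _ (λ r _ → ω-nonzero (+ suc r) (λ ()))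

  φ⁻¹ : ℤ → F
  φ⁻¹ (+ n)    = invF (φF n) (φ-nonzero n)
  φ⁻¹ -[1+ n ] = 0F

  -- φ_z for z ≥ 0 (only ever used at nonnegative arguments).
  φℤ : ℤ → F
  φℤ (+ n)    = φF n
  φℤ -[1+ n ] = 1F

  φ-φ⁻¹ : ∀ n → φF n *F φ⁻¹ (+ n) ≈F 1F
  φ-φ⁻¹ n = invF-inverse (φF n) (φ-nonzero n)

  φ⁻¹-0 : φ⁻¹ (+ 0) ≈F 1F
  φ⁻¹-0 = FR.trans (FR.sym (FR.*-identityˡ _)) (φ-φ⁻¹ 0)

  φ⁻¹-step : ∀ z → φ⁻¹ (z ℤ.- + 1) ≈F φ⁻¹ z *F ω z
  φ⁻¹-step (+ zero)  = FR.sym (FR.trans (FR.refl ⟨*⟩ ω-0) (FR.zeroʳ _))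
  φ⁻¹-step (+ suc n) = begin
    invF (φF n) (φ-nonzero n)                                      ≈⟨ FR.sym (FR.*-identityʳ _) ⟩
    invF (φF n) (φ-nonzero n) *F 1F                                ≈⟨ FR.refl ⟨*⟩ FR.sym (invF-inverse (ω (+ suc n)) (ω-nonzero (+ suc n) (λ ()))) ⟩
    invF (φF n) (φ-nonzero n) *F (ω (+ suc n) *F ω⁻¹)              ≈⟨ solve 3 (λ a w i → a :* (w :* i) := (a :* i) :* w) FR.refl _ (ω (+ suc n)) ω⁻¹ ⟩
    (invF (φF n) (φ-nonzero n) *F ω⁻¹) *F ω (+ suc n)              ≈⟨ FR.sym (invF-* (φF n) (ω (+ suc n)) (φ-nonzero (suc n)) (φ-nonzero n) _) ⟨*⟩ FR.refl ⟩
    invF (φF (suc n)) (φ-nonzero (suc n)) *F ω (+ suc n)           ∎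
    where ω⁻¹ = invF (ω (+ suc n)) (ω-nonzero (+ suc n) (λ ()))
  φ⁻¹-step -[1+ n ]  = FR.sym (FR.zeroˡ _)

  φ⁻¹-step' : ∀ z w → w ≡ z ℤ.- + 1 → φ⁻¹ w ≈F φ⁻¹ z *F ω z
  φ⁻¹-step' z _ refl = φ⁻¹-step z

  negative-difference : ∀ a b → a < b → ∃ λ k → + a ℤ.- + b ≡ -[1+ k ]
  negative-difference a b a<b = b ℕ.∸ suc a ,
    trans (ℤP.m-n≡m⊖n a b) (trans (ℤP.⊖-< a<b) (cong (λ n → ℤ.- (+ n)) (gap a b a<b)))
    where
    gap : ∀ a b → a < b → b ℕ.∸ a ≡ suc (b ℕ.∸ suc a)
    gap zero    (suc b) _         = refl
    gap (suc a) (suc b) (s≤s a<b) = gap a b a<b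

  φ⁻¹-below : ∀ a b → a < b → φ⁻¹ (+ a ℤ.- + b) ≈F 0F
  φ⁻¹-below a b a<b with negative-difference a b a<b
  ... | k , e = ≈F-reflexive (cong φ⁻¹ e)

  φℤ-step : ∀ z w k → z ≡ + suc k → w ≡ z ℤ.- + 1 → φℤ z ≈F φℤ w *F ω z
  φℤ-step z w k refl refl = FR.refl

  φ⁻¹-below-zero : ∀ n → φ⁻¹ ((+ 0 ℤ.- + 1) ℤ.- + n) ≈F 0F
  φ⁻¹-below-zero zero    = FR.refl
  φ⁻¹-below-zero (suc n) = FR.refl

module LiftOfU where
  open Polynomials
  open PolynomialDomain
  open Fractions
  open PowersAndSums
  open Phi
  open +-*-Solver using () renaming (solve to zsolve; _:+_ to _+'_; :-_ to -'_; _:=_ to _='_)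

  pochF : F → ℕ → F
  pochF a n = prodF n (λ k → 1F -F a *F tpowF (+ k))

  raw-poch : ∀ z n → raw (pochF (tpowF z) n) ≡ poch (tpow z) n
  raw-poch z n = raw-prod n _ _ λ k _ →
    trans (raw-- 1F _) (cong (oneR -R_) (trans (raw-* (tpowF z) (tpowF (+ k))) (cong₂ _*R_ (raw-tpow z) (raw-tpow (+ k)))))

  poch-factor : ∀ z k → 1F -F tpowF z *F tpowF (+ k) ≈F ω (z ℤ.+ + k)
  poch-factor z k = begin
    1F -F tpowF z *F tpowF (+ k)      ≈⟨ -F≈ 1F _ ⟩
    1F +F -F (tpowF z *F tpowF (+ k)) ≈⟨ FR.refl ⟨+⟩ FR.-‿cong (FR.sym (tpow-+ z (+ k))) ⟩
    1F +F -F tpowF (z ℤ.+ + k)        ≈⟨ FR.sym (ω≈ (z ℤ.+ + k)) ⟩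
    ω (z ℤ.+ + k)                     ∎

  -m+k≢0 : ∀ m k → k < m → ¬ (ℤ.- (+ m) ℤ.+ + k ≡ + 0)
  -m+k≢0 m k k<m e = ℕP.<-irrefl (sym (ℤP.+-injective m≡k)) k<m
    where
    m≡k : + m ≡ + k
    m≡k = sym (trans (zsolve 2 (λ m k → k =' (-' m +' k) +' m) refl (+ m) (+ k)) (cong (ℤ._+ + m) e))

  γ-nonzero : ∀ k → NZE (1F -F tpowF (+ 1) *F tpowF (+ k))
  γ-nonzero k = NZE-≈ (poch-factor (+ 1) k) (ω-nonzero (+ 1 ℤ.+ + k) (λ ()))

  δ-nonzero : ∀ m k → k < m → NZE (1F -F tpowF (ℤ.- (+ m)) *F tpowF (+ k))
  δ-nonzero m k k<m = NZE-≈ (poch-factor (ℤ.- (+ m)) k) (ω-nonzero _ (-m+k≢0 m k k<m))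

  denominator-nonzero : ∀ m n → n ≤ m → NZE (pochF (tpowF (+ 1)) n *F pochF (tpowF (ℤ.- (+ m))) n)
  denominator-nonzero m n n≤m = NZE-* {pochF (tpowF (+ 1)) n} {pochF (tpowF (ℤ.- (+ m))) n}
    (NZE-prod n _ (λ k _ → γ-nonzero k))
    (NZE-prod n _ (λ k k<n → δ-nonzero m k (ℕP.<-≤-trans k<n n≤m)))

  -- The n-th term of 2φ1(t^{-i}, t^{-i'}; t^{-m}; t, t^c); it is only
  -- consulted for n ≤ min(i, i') ≤ m.
  termF : ℕ → ℕ → ℕ → ℕ → ℕ → F
  termF i i' m c n with n ℕP.≤? m
  ... | yes n≤m = ((pochF (tpowF (ℤ.- (+ i))) n *F pochF (tpowF (ℤ.- (+ i'))) n)
                   *F invF (pochF (tpowF (+ 1)) n *F pochF (tpowF (ℤ.- (+ m))) n) (denominator-nonzero m n n≤m))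
                  *F tpowF (+ (n ℕ.* c))
  ... | no _    = 0F

  phi21F : ℕ → ℕ → ℕ → ℕ → F
  phi21F i i' m c = sumF (suc (i ⊓ i')) (termF i i' m c)

  raw-phi21 : ∀ i i' m c → i ≤ m → raw (phi21F i i' m c) ≡ phi21 i i' m c
  raw-phi21 i i' m c i≤m = raw-sum (suc (i ⊓ i')) _ _ term
    where
    term : ∀ n → n < suc (i ⊓ i') → raw (termF i i' m c n) ≡ _
    term n n< with n ℕP.≤? m
    ... | yes n≤m = trans (raw-* _ (tpowF (+ (n ℕ.* c)))) (cong₂ _*R_
           (trans (raw-/ _ _ (denominator-nonzero m n n≤m))
                  (cong₂ _/R_ (trans (raw-* _ _) (cong₂ _*R_ (raw-poch (ℤ.- (+ i)) n) (raw-poch (ℤ.- (+ i')) n)))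
                              (trans (raw-* _ _) (cong₂ _*R_ (raw-poch (+ 1) n) (raw-poch (ℤ.- (+ m)) n)))))
           (raw-tpow (+ (n ℕ.* c))))
    ... | no n≰m  = ⊥-elim (n≰m (ℕP.≤-trans (ℕP.≤-pred n<) (ℕP.≤-trans (ℕP.m⊓n≤m i i') i≤m)))

  φ-product : ℕ → ℕ → ℕ → ℕ → ℕ → F
  φ-product i i' i'' j j'' = φF i *F φF i' *F φF i'' *F φF j *F φF j''

  φ-product-nonzero : ∀ i i' i'' j j'' → NZE (φ-product i i' i'' j j'')
  φ-product-nonzero i i' i'' j j'' =
    NZE-* {φF i *F φF i' *F φF i'' *F φF j} {φF j''}
      (NZE-* {φF i *F φF i' *F φF i''} {φF j}
        (NZE-* {φF i *F φF i'} {φF i''} (NZE-* {φF i} {φF i'} (φ-nonzero i) (φ-nonzero i')) (φ-nonzero i''))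
        (φ-nonzero j))
      (φ-nonzero j'')

  prefactor : ℕ → ℕ → ℕ → ℕ → ℕ → ℕ → F
  prefactor j i j' i' j'' i'' = φF (i ℕ.+ j) *F invF (φ-product i i' i'' j j'') (φ-product-nonzero i i' i'' j j'')

  uF : ℕ → ℕ → ℕ → ℕ → ℕ → ℕ → F
  uF j i j' i' j'' i'' = prefactor j i j' i' j'' i'' *F phi21F i i' (i ℕ.+ j) (suc i'')

  raw-u : ∀ j i j' i' j'' i'' → raw (uF j i j' i' j'' i'') ≡ u j i j' i' j'' i''
  raw-u j i j' i' j'' i'' = trans (raw-* _ _) (cong₂ _*R_
    (trans (raw-/ _ _ _) (cong₂ _/R_ (raw-φ (i ℕ.+ j))
       (trans (raw-* _ _) (cong₂ _*R_ (trans (raw-* _ _) (cong₂ _*R_ (trans (raw-* _ _) (cong₂ _*R_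
         (trans (raw-* _ _) (cong₂ _*R_ (raw-φ i) (raw-φ i'))) (raw-φ i''))) (raw-φ j))) (raw-φ j'')))))
    (raw-phi21 i i' (i ℕ.+ j) (suc i'') (ℕP.m≤m+n i j)))

-- Step 1: u = Σ_n τ(n), a sum of products of φ's and powers of t.
module TermExpansion where
  open Polynomials
  open PolynomialDomain
  open Fractions
  open PowersAndSums
  open Phi
  open LiftOfU
  open +-*-Solver using ()
    renaming (solve to zsolve; _:+_ to _+'_; _:-_ to _-'_; :-_ to -'_; _:=_ to _='_; con to ι)
  open FS using (solve; _:+_; _:*_; :-_; _:=_; con)

  σ : ℤ → ℕ → F
  σ m zero    = 1F
  σ m (suc n) = σ m n *F -F tpowF (m ℤ.+ + suc n)

  -- Integer arguments are allowed; by the convention on 1/φ the term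
  -- vanishes as soon as one of n, i-n, i'-n, i'', j, j'' is negative.
  τ : ℤ → ℤ → ℤ → ℤ → ℤ → ℤ → ℕ → F
  τ j i j' i' j'' i'' n = σ j' n *F φℤ (i ℤ.+ j ℤ.- + n) *F φ⁻¹ (+ n) *F φ⁻¹ (i ℤ.- + n) *F φ⁻¹ (i' ℤ.- + n)
                          *F (φ⁻¹ i'' *F φ⁻¹ j *F φ⁻¹ j'')

  ω-neg : ∀ z → ω (ℤ.- z) ≈F -F tpowF (ℤ.- z) *F ω z
  ω-neg z = begin
    ω (ℤ.- z)                                      ≈⟨ ω≈ (ℤ.- z) ⟩
    1F +F -F tpowF (ℤ.- z)                         ≈⟨ FR.sym t⁻ᶻtᶻ ⟨+⟩ FR.refl ⟩
    tpowF (ℤ.- z) *F tpowF z +F -F tpowF (ℤ.- z)   ≈⟨ solve 2 (λ a b → a :* b :+ :- a := :- a :* (con (+ 1) :+ :- b)) FR.refl (tpowF (ℤ.- z)) (tpowF z) ⟩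
    -F tpowF (ℤ.- z) *F (1F +F -F tpowF z)         ≈⟨ FR.refl ⟨*⟩ FR.sym (ω≈ z) ⟩
    -F tpowF (ℤ.- z) *F ω z                        ∎
    where
    t⁻ᶻtᶻ : tpowF (ℤ.- z) *F tpowF z ≈F 1F
    t⁻ᶻtᶻ = FR.trans (FR.sym (tpow-+ (ℤ.- z) z)) (FR.trans (tpow-cong (ℤP.+-inverseˡ z)) tpow-0)

  τ-ratio : ∀ j i j' i' j'' i'' n k → i'' ℤ.+ j ≡ i' ℤ.+ j' → i ℤ.+ j ℤ.- + n ≡ + suc k →
    τ j i j' i' j'' i'' (suc n) *F (ω (+ suc n) *F (-F tpowF (+ n ℤ.- (i ℤ.+ j)) *F ω (i ℤ.+ j ℤ.- + n)))
    ≈F τ j i j' i' j'' i'' n *F ((tpowF (+ n ℤ.- i) *F ω (i ℤ.- + n)) *F (tpowF (+ n ℤ.- i') *F ω (i' ℤ.- + n)) *F tpowF (i'' ℤ.+ + 1))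
  τ-ratio j i j' i' j'' i'' n k w ek = begin
    (S *F -F X₁ *F P₁ *F I₁ *F φ⁻¹ (i ℤ.- + suc n) *F φ⁻¹ (i' ℤ.- + suc n) *F R) *F (ω (+ suc n) *F (-F X₂ *F ωij))
      ≈⟨ (FR.refl ⟨*⟩ FR.refl ⟨*⟩ FR.refl ⟨*⟩ FR.refl ⟨*⟩ φ⁻¹-step' (i ℤ.- + n) _ (pred-diff i) ⟨*⟩ φ⁻¹-step' (i' ℤ.- + n) _ (pred-diff i') ⟨*⟩ FR.refl) ⟨*⟩ FR.refl ⟩
    (S *F -F X₁ *F P₁ *F I₁ *F (Iᵢ *F ωᵢ) *F (Iᵢ' *F ωᵢ') *F R) *F (ω (+ suc n) *F (-F X₂ *F ωij))
      ≈⟨ solve 12 (λ S X₁ P₁ I₁ Iᵢ ωᵢ Iᵢ' ωᵢ' R ωₙ X₂ ωij → (S :* (:- X₁) :* P₁ :* I₁ :* (Iᵢ :* ωᵢ) :* (Iᵢ' :* ωᵢ') :* R) :* (ωₙ :* (:- X₂ :* ωij))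
            := (S :* (P₁ :* ωij) :* (I₁ :* ωₙ) :* Iᵢ :* Iᵢ' :* R) :* ((ωᵢ :* ωᵢ') :* (X₁ :* X₂)))
            FR.refl S X₁ P₁ I₁ Iᵢ ωᵢ Iᵢ' ωᵢ' R (ω (+ suc n)) X₂ ωij ⟩
    (S *F (P₁ *F ωij) *F (I₁ *F ω (+ suc n)) *F Iᵢ *F Iᵢ' *F R) *F ((ωᵢ *F ωᵢ') *F (X₁ *F X₂))
      ≈⟨ (FR.refl ⟨*⟩ FR.sym (φℤ-step _ _ k ek (pred-diff (i ℤ.+ j))) ⟨*⟩ FR.sym (φ⁻¹-step' (+ suc n) (+ n) refl) ⟨*⟩ FR.refl ⟨*⟩ FR.refl ⟨*⟩ FR.refl) ⟨*⟩ (FR.refl ⟨*⟩ exponents) ⟩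
    τ j i j' i' j'' i'' n *F ((ωᵢ *F ωᵢ') *F (Y₁ *F Y₂ *F Y₃))
      ≈⟨ FR.refl ⟨*⟩ solve 5 (λ a b x y z → (a :* b) :* (x :* y :* z) := (x :* a) :* (y :* b) :* z) FR.refl ωᵢ ωᵢ' Y₁ Y₂ Y₃ ⟩
    τ j i j' i' j'' i'' n *F ((Y₁ *F ωᵢ) *F (Y₂ *F ωᵢ') *F Y₃) ∎
    where
    S X₁ X₂ Y₁ Y₂ Y₃ P₁ I₁ Iᵢ Iᵢ' ωᵢ ωᵢ' ωij R : F
    S   = σ j' n
    X₁  = tpowF (j' ℤ.+ + suc n)
    X₂  = tpowF (+ n ℤ.- (i ℤ.+ j))
    Y₁  = tpowF (+ n ℤ.- i)
    Y₂  = tpowF (+ n ℤ.- i')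
    Y₃  = tpowF (i'' ℤ.+ + 1)
    P₁  = φℤ (i ℤ.+ j ℤ.- + suc n)
    I₁  = φ⁻¹ (+ suc n)
    Iᵢ  = φ⁻¹ (i ℤ.- + n)
    Iᵢ' = φ⁻¹ (i' ℤ.- + n)
    ωᵢ  = ω (i ℤ.- + n)
    ωᵢ' = ω (i' ℤ.- + n)
    ωij = ω (i ℤ.+ j ℤ.- + n)
    R   = φ⁻¹ i'' *F φ⁻¹ j *F φ⁻¹ j''
    pred-diff : ∀ a → a ℤ.- + suc n ≡ (a ℤ.- + n) ℤ.- + 1
    pred-diff a = zsolve 2 (λ a n → a -' (ι (+ 1) +' n) =' (a -' n) -' ι (+ 1)) refl a (+ n)
    exponent : (j' ℤ.+ + suc n) ℤ.+ (+ n ℤ.- (i ℤ.+ j)) ≡ ((+ n ℤ.- i) ℤ.+ (+ n ℤ.- i')) ℤ.+ (i'' ℤ.+ + 1)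
    exponent = trans (zsolve 5 (λ j' n i j i' → (j' +' (ι (+ 1) +' n)) +' (n -' (i +' j)) =' ((n -' i) +' (n -' i')) +' (i' +' j') -' j +' ι (+ 1)) refl j' (+ n) i j i')
               (trans (cong (λ s → ((+ n ℤ.- i) ℤ.+ (+ n ℤ.- i')) ℤ.+ s ℤ.- j ℤ.+ + 1) (sym w))
                      (zsolve 5 (λ n i i' i'' j → ((n -' i) +' (n -' i')) +' (i'' +' j) -' j +' ι (+ 1) =' ((n -' i) +' (n -' i')) +' (i'' +' ι (+ 1))) refl (+ n) i i' i'' j))
    exponents : X₁ *F X₂ ≈F Y₁ *F Y₂ *F Y₃
    exponents = begin
      X₁ *F X₂                                                        ≈⟨ FR.sym (tpow-+ _ _) ⟩
      tpowF ((j' ℤ.+ + suc n) ℤ.+ (+ n ℤ.- (i ℤ.+ j)))                ≈⟨ tpow-cong exponent ⟩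
      tpowF (((+ n ℤ.- i) ℤ.+ (+ n ℤ.- i')) ℤ.+ (i'' ℤ.+ + 1))        ≈⟨ tpow-+ _ _ ⟩
      tpowF ((+ n ℤ.- i) ℤ.+ (+ n ℤ.- i')) *F Y₃                      ≈⟨ tpow-+ _ _ ⟨*⟩ FR.refl ⟩
      Y₁ *F Y₂ *F Y₃                                                  ∎

  ratio-induction : ∀ N (X Y : ℕ → F) (ρ : ∀ n → n < N → F) → X 0 ≈F Y 0 →
    (∀ n (n<N : n < N) → X (suc n) ≈F X n *F ρ n n<N) →
    (∀ n (n<N : n < N) → Y (suc n) ≈F Y n *F ρ n n<N) →
    ∀ n → n ≤ N → X n ≈F Y n
  ratio-induction N X Y ρ X₀≈Y₀ ratioX ratioY zero    _   = X₀≈Y₀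
  ratio-induction N X Y ρ X₀≈Y₀ ratioX ratioY (suc n) n<N = begin
    X (suc n)     ≈⟨ ratioX n n<N ⟩
    X n *F ρ n n<N ≈⟨ ratio-induction N X Y ρ X₀≈Y₀ ratioX ratioY n (ℕP.<⇒≤ n<N) ⟨*⟩ FR.refl ⟩
    Y n *F ρ n n<N ≈⟨ FR.sym (ratioY n n<N) ⟩
    Y (suc n)     ∎

  module Expansion (j i j' i' j'' i'' : ℕ) (w : i'' ℕ.+ j ≡ i' ℕ.+ j') where

    private
      m c : ℕ
      m = i ℕ.+ j
      c = suc i''
      A B Q C : ℕ → F
      A = pochF (tpowF (ℤ.- (+ i)))
      B = pochF (tpowF (ℤ.- (+ i')))
      Q = pochF (tpowF (+ 1))
      C = pochF (tpowF (ℤ.- (+ m)))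
      α β γ δ : ℕ → F
      α n = 1F -F tpowF (ℤ.- (+ i)) *F tpowF (+ n)
      β n = 1F -F tpowF (ℤ.- (+ i')) *F tpowF (+ n)
      γ n = 1F -F tpowF (+ 1) *F tpowF (+ n)
      δ n = 1F -F tpowF (ℤ.- (+ m)) *F tpowF (+ n)

      γδ-nonzero : ∀ n → n < m → NZE (γ n *F δ n)
      γδ-nonzero n n<m = NZE-* {γ n} {δ n} (γ-nonzero n) (δ-nonzero m n n<m)

      QC⁻¹ : ∀ n → n ≤ m → F
      QC⁻¹ n n≤m = invF (Q n *F C n) (denominator-nonzero m n n≤m)

      ρ : ∀ n → n < m → F
      ρ n n<m = (α n *F β n *F tpowF (+ c)) *F invF (γ n *F δ n) (γδ-nonzero n n<m)

      X Y : ℕ → F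
      X n = prefactor j i j' i' j'' i'' *F termF i i' m c n
      Y   = τ (+ j) (+ i) (+ j') (+ i') (+ j'') (+ i'')

      term-≤ : ∀ n (n≤m : n ≤ m) → termF i i' m c n ≈F ((A n *F B n) *F QC⁻¹ n n≤m) *F tpowF (+ (n ℕ.* c))
      term-≤ n n≤m with n ℕP.≤? m
      ... | yes n≤m' = ≈F-reflexive (cong (λ p → ((A n *F B n) *F QC⁻¹ n p) *F tpowF (+ (n ℕ.* c))) (ℕP.≤-irrelevant n≤m' n≤m))
      ... | no n≰m   = ⊥-elim (n≰m n≤m)

      term-ratio : ∀ n (n<m : n < m) → termF i i' m c (suc n) ≈F termF i i' m c n *F ρ n n<m
      term-ratio n n<m = begin
        termF i i' m c (suc n)
          ≈⟨ term-≤ (suc n) n<m ⟩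
        ((A n *F α n *F (B n *F β n)) *F invF (Q n *F γ n *F (C n *F δ n)) _) *F tpowF (+ (suc n ℕ.* c))
          ≈⟨ (FR.refl ⟨*⟩ FR.trans (invF-cong _ _ _ QCγδ≢0 (solve 4 (λ q g c d → q :* g :* (c :* d) := (q :* c) :* (g :* d)) FR.refl (Q n) (γ n) (C n) (δ n)))
                                   (invF-* _ _ QCγδ≢0 (denominator-nonzero m n (ℕP.<⇒≤ n<m)) (γδ-nonzero n n<m)))
             ⟨*⟩ FR.trans (tpow-cong (ℤP.pos-+ c (n ℕ.* c))) (tpow-+ (+ c) (+ (n ℕ.* c))) ⟩
        ((A n *F α n *F (B n *F β n)) *F (QC⁻¹ n (ℕP.<⇒≤ n<m) *F γδ⁻¹)) *F (tpowF (+ c) *F tpowF (+ (n ℕ.* c)))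
          ≈⟨ solve 8 (λ a α b β qc gd tc tn → (a :* α :* (b :* β)) :* (qc :* gd) :* (tc :* tn)
                := ((a :* b) :* qc :* tn) :* ((α :* β :* tc) :* gd))
                FR.refl (A n) (α n) (B n) (β n) (QC⁻¹ n (ℕP.<⇒≤ n<m)) γδ⁻¹ (tpowF (+ c)) (tpowF (+ (n ℕ.* c))) ⟩
        ((A n *F B n) *F QC⁻¹ n (ℕP.<⇒≤ n<m) *F tpowF (+ (n ℕ.* c))) *F ρ n n<m
          ≈⟨ FR.sym (term-≤ n (ℕP.<⇒≤ n<m)) ⟨*⟩ FR.refl ⟩
        termF i i' m c n *F ρ n n<m ∎
        where
        QCγδ≢0 : NZE ((Q n *F C n) *F (γ n *F δ n))
        QCγδ≢0 = NZE-* {Q n *F C n} {γ n *F δ n} (denominator-nonzero m n (ℕP.<⇒≤ n<m)) (γδ-nonzero n n<m)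
        γδ⁻¹ : F
        γδ⁻¹ = invF (γ n *F δ n) (γδ-nonzero n n<m)

      X-ratio : ∀ n (n<m : n < m) → X (suc n) ≈F X n *F ρ n n<m
      X-ratio n n<m = FR.trans (FR.refl ⟨*⟩ term-ratio n n<m) (FR.sym (FR.*-assoc _ _ _))

      reflected-factor : ∀ a n → 1F -F tpowF (ℤ.- a) *F tpowF (+ n) ≈F -F tpowF (+ n ℤ.- a) *F ω (a ℤ.- + n)
      reflected-factor a n = begin
        1F -F tpowF (ℤ.- a) *F tpowF (+ n)               ≈⟨ poch-factor (ℤ.- a) n ⟩
        ω (ℤ.- a ℤ.+ + n)                                ≈⟨ ≈F-reflexive (cong ω (zsolve 2 (λ a n → -' a +' n =' -' (a -' n)) refl a (+ n))) ⟩
        ω (ℤ.- (a ℤ.- + n))                              ≈⟨ ω-neg (a ℤ.- + n) ⟩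
        -F tpowF (ℤ.- (a ℤ.- + n)) *F ω (a ℤ.- + n)      ≈⟨ FR.-‿cong (tpow-cong (zsolve 2 (λ a n → -' (a -' n) =' n -' a) refl a (+ n))) ⟨*⟩ FR.refl ⟩
        -F tpowF (+ n ℤ.- a) *F ω (a ℤ.- + n)            ∎

      Y-ratio : ∀ n (n<m : n < m) → Y (suc n) ≈F Y n *F ρ n n<m
      Y-ratio n n<m = FR.sym (begin
        Y n *F ((α n *F β n *F tpowF (+ c)) *F γδ⁻¹)
          ≈⟨ FR.refl ⟨*⟩ ((reflected-factor (+ i) n ⟨*⟩ reflected-factor (+ i') n ⟨*⟩ tpow-cong (cong +_ (ℕP.+-comm 1 i''))) ⟨*⟩ FR.refl) ⟩
        Y n *F (((-F y₁ *F o₁) *F (-F y₂ *F o₂) *F tpowF (+ i'' ℤ.+ + 1)) *F γδ⁻¹)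
          ≈⟨ solve 7 (λ Y a b c d e g → Y :* (((:- a :* b) :* (:- c :* d) :* e) :* g) := (Y :* ((a :* b) :* (c :* d) :* e)) :* g) FR.refl (Y n) y₁ o₁ y₂ o₂ _ γδ⁻¹ ⟩
        (Y n *F ((y₁ *F o₁) *F (y₂ *F o₂) *F tpowF (+ i'' ℤ.+ + 1))) *F γδ⁻¹
          ≈⟨ FR.sym (τ-ratio (+ j) (+ i) (+ j') (+ i') (+ j'') (+ i'') n (m ℕ.∸ suc n) (cong +_ w) i+j-n) ⟨*⟩ FR.refl ⟩
        (Y (suc n) *F (ω (+ suc n) *F (-F tpowF (+ n ℤ.- (+ i ℤ.+ + j)) *F ω (+ i ℤ.+ + j ℤ.- + n)))) *F γδ⁻¹
          ≈⟨ (FR.refl ⟨*⟩ FR.sym (poch-factor (+ 1) n ⟨*⟩ reflected-factor (+ m) n)) ⟨*⟩ FR.refl ⟩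
        (Y (suc n) *F (γ n *F δ n)) *F γδ⁻¹
          ≈⟨ FR.*-assoc _ _ _ ⟩
        Y (suc n) *F ((γ n *F δ n) *F γδ⁻¹)
          ≈⟨ FR.refl ⟨*⟩ invF-inverse _ _ ⟩
        Y (suc n) *F 1F
          ≈⟨ FR.*-identityʳ _ ⟩
        Y (suc n) ∎)
        where
        γδ⁻¹ : F
        γδ⁻¹ = invF (γ n *F δ n) (γδ-nonzero n n<m)
        y₁ y₂ o₁ o₂ : F
        y₁ = tpowF (+ n ℤ.- + i)
        y₂ = tpowF (+ n ℤ.- + i')
        o₁ = ω (+ i ℤ.- + n)
        o₂ = ω (+ i' ℤ.- + n)
        i+j-n : + i ℤ.+ + j ℤ.- + n ≡ + suc (m ℕ.∸ suc n)
        i+j-n = trans (ℤP.m-n≡m⊖n m n) (trans (ℤP.⊖-≥ (ℕP.<⇒≤ n<m)) (cong +_ (gap m n n<m)))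
          where
          gap : ∀ a b → b < a → a ℕ.∸ b ≡ suc (a ℕ.∸ suc b)
          gap (suc a) zero    _         = refl
          gap (suc a) (suc b) (s≤s b<a) = gap a b b<a

      φ-product⁻¹ : ∀ p → invF (φ-product i i' i'' j j'') p ≈F φ⁻¹ (+ i) *F φ⁻¹ (+ i') *F φ⁻¹ (+ i'') *F φ⁻¹ (+ j) *F φ⁻¹ (+ j'')
      φ-product⁻¹ p = begin
        invF (φ-product i i' i'' j j'') p                      ≈⟨ invF-* _ _ p n₄ (φ-nonzero j'') ⟩
        invF f₄ n₄ *F φ⁻¹ (+ j'')                              ≈⟨ invF-* _ _ n₄ n₃ (φ-nonzero j) ⟨*⟩ FR.refl ⟩
        invF f₃ n₃ *F φ⁻¹ (+ j) *F φ⁻¹ (+ j'')                 ≈⟨ invF-* _ _ n₃ n₂ (φ-nonzero i'') ⟨*⟩ FR.refl ⟨*⟩ FR.refl ⟩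
        invF f₂ n₂ *F φ⁻¹ (+ i'') *F φ⁻¹ (+ j) *F φ⁻¹ (+ j'')  ≈⟨ invF-* _ _ n₂ (φ-nonzero i) (φ-nonzero i') ⟨*⟩ FR.refl ⟨*⟩ FR.refl ⟨*⟩ FR.refl ⟩
        φ⁻¹ (+ i) *F φ⁻¹ (+ i') *F φ⁻¹ (+ i'') *F φ⁻¹ (+ j) *F φ⁻¹ (+ j'') ∎
        where
        f₂ f₃ f₄ : F
        f₂ = φF i *F φF i'
        f₃ = f₂ *F φF i''
        f₄ = f₃ *F φF j
        n₂ : NZE f₂
        n₂ = NZE-* {φF i} {φF i'} (φ-nonzero i) (φ-nonzero i')
        n₃ : NZE f₃
        n₃ = NZE-* {f₂} {φF i''} n₂ (φ-nonzero i'')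
        n₄ : NZE f₄
        n₄ = NZE-* {f₃} {φF j} n₃ (φ-nonzero j)

      initial : X 0 ≈F Y 0
      initial = begin
        prefactor j i j' i' j'' i'' *F termF i i' m c 0
          ≈⟨ (FR.refl ⟨*⟩ φ-product⁻¹ _) ⟨*⟩ term-≤ 0 z≤n ⟩
        (φF m *F I₅) *F (((1F *F 1F) *F QC⁻¹ 0 z≤n) *F tpowF (+ 0))
          ≈⟨ FR.refl ⟨*⟩ ((FR.refl ⟨*⟩ FR.trans (invF-cong _ 1F _ NZ-oneP (FR.*-identityˡ 1F)) (FR.trans (FR.sym (FR.*-identityˡ _)) (invF-inverse 1F NZ-oneP))) ⟨*⟩ tpow-0) ⟩
        (φF m *F I₅) *F (((1F *F 1F) *F 1F) *F 1F)
          ≈⟨ solve 6 (λ p a b c d e → (p :* (a :* b :* c :* d :* e)) :* (((con (+ 1) :* con (+ 1)) :* con (+ 1)) :* con (+ 1))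
                := con (+ 1) :* p :* con (+ 1) :* a :* b :* (c :* d :* e))
                FR.refl (φF m) (φ⁻¹ (+ i)) (φ⁻¹ (+ i')) (φ⁻¹ (+ i'')) (φ⁻¹ (+ j)) (φ⁻¹ (+ j'')) ⟩
        1F *F φF m *F 1F *F φ⁻¹ (+ i) *F φ⁻¹ (+ i') *F (φ⁻¹ (+ i'') *F φ⁻¹ (+ j) *F φ⁻¹ (+ j''))
          ≈⟨ FR.refl ⟨*⟩ ≈F-reflexive (cong φℤ (sym (ℤP.+-identityʳ (+ m)))) ⟨*⟩ FR.sym φ⁻¹-0
               ⟨*⟩ ≈F-reflexive (cong φ⁻¹ (sym (ℤP.+-identityʳ (+ i)))) ⟨*⟩ ≈F-reflexive (cong φ⁻¹ (sym (ℤP.+-identityʳ (+ i')))) ⟨*⟩ FR.refl ⟩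
        Y 0 ∎
        where I₅ = φ⁻¹ (+ i) *F φ⁻¹ (+ i') *F φ⁻¹ (+ i'') *F φ⁻¹ (+ j) *F φ⁻¹ (+ j'')

      -- τ(n) = 0 beyond min(i, i'), where 1/φ_{i-n} or 1/φ_{i'-n} vanishes.
      Y-vanishes : ∀ n → suc (i ⊓ i') ≤ n → Y n ≈F 0F
      Y-vanishes n i⊓i'<n with ℕP.≤-total i i'
      ... | inj₁ i≤i' = FR.trans (FR.refl ⟨*⟩ φ⁻¹-below i n (subst (_< n) (ℕP.m≤n⇒m⊓n≡m i≤i') i⊓i'<n) ⟨*⟩ FR.refl ⟨*⟩ FR.refl)
                                 (solve 3 (λ a b c → a :* con (+ 0) :* b :* c := con (+ 0)) FR.refl _ _ _)
      ... | inj₂ i'≤i = FR.trans (FR.refl ⟨*⟩ φ⁻¹-below i' n (subst (_< n) (ℕP.m≥n⇒m⊓n≡n i'≤i) i⊓i'<n) ⟨*⟩ FR.refl)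
                                 (solve 2 (λ a b → a :* con (+ 0) :* b := con (+ 0)) FR.refl _ _)

    expansion : ∀ K → suc (i ⊓ i') ≤ K → uF j i j' i' j'' i'' ≈F sumF K (τ (+ j) (+ i) (+ j') (+ i') (+ j'') (+ i''))
    expansion K K-large = begin
      uF j i j' i' j'' i''        ≈⟨ sum-*ˡ (suc (i ⊓ i')) _ _ ⟩
      sumF (suc (i ⊓ i')) X       ≈⟨ sum-cong (suc (i ⊓ i')) (λ n n≤i⊓i' → ratio-induction m X Y ρ initial X-ratio Y-ratio n (n≤m n≤i⊓i')) ⟩
      sumF (suc (i ⊓ i')) Y       ≈⟨ FR.sym (sum-extend (suc (i ⊓ i')) K Y Y-vanishes K-large) ⟩
      sumF K Y                    ∎
      where
      n≤m : ∀ {n} → n < suc (i ⊓ i') → n ≤ m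
      n≤m n≤i⊓i' = ℕP.≤-trans (ℕP.≤-pred n≤i⊓i') (ℕP.≤-trans (ℕP.m⊓n≤m i i') (ℕP.m≤m+n i j))

module ContiguousRelation where
  open Polynomials
  open PolynomialDomain
  open Fractions
  open PowersAndSums

  -- The weight condition i' - j = i'' - j' = i - j'' in additive form.
  record Balanced (j i j' i' j'' i'' : ℕ) : Set where
    constructor balanced
    field
      i''j≡i'j' : i'' ℕ.+ j ≡ i' ℕ.+ j'
      i'j''≡ij  : i' ℕ.+ j'' ≡ i ℕ.+ j
      i''j''≡ij' : i'' ℕ.+ j'' ≡ i ℕ.+ j'
  open Balanced public

  Hexagonal : Set
  Hexagonal = ℕ → ℕ → ℕ → ℕ → ℕ → ℕ → F

  -- The two neighbours of X(j, a+1, j', i', j'', i'') in the contiguous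
  -- relation: X(j, a, j', i', j''-1, i'') and X(j, a, j', i'-1, j'', i''-1),
  -- read as 0 when an index would become negative.
  left-neighbour : Hexagonal → Hexagonal
  left-neighbour X j a j' i' zero    i'' = 0F
  left-neighbour X j a j' i' (suc b) i'' = X j a j' i' b i''

  centre-neighbour : Hexagonal → Hexagonal
  centre-neighbour X j a j' (suc p) j'' (suc q) = X j a j' p j'' q
  centre-neighbour X j a j' _       j'' _       = 0F

  Contiguous : Hexagonal → Set
  Contiguous X = ∀ j a j' i' j'' i'' → Balanced j (suc a) j' i' j'' i'' →
    left-neighbour X j a j' i' j'' i'' +F tpowF (+ j'') *F centre-neighbour X j a j' i' j'' i''
    ≈F ω (+ suc a) *F X j (suc a) j' i' j'' i''

  -- Since 1 - t^{a+1} ≠ 0, the contiguous relation determines a balanced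
  -- family from its values at i = 0.
  contiguous-unique : ∀ U V → Contiguous U → Contiguous V →
    (∀ j j' i' j'' i'' → Balanced j 0 j' i' j'' i'' → U j 0 j' i' j'' i'' ≈F V j 0 j' i' j'' i'') →
    ∀ j i j' i' j'' i'' → Balanced j i j' i' j'' i'' → U j i j' i' j'' i'' ≈F V j i j' i' j'' i''
  contiguous-unique U V contU contV initial j zero    j' i' j'' i'' bal = initial j j' i' j'' i'' bal
  contiguous-unique U V contU contV initial j (suc a) j' i' j'' i'' bal =
    cancelF (ω (+ suc a)) _ _ (ω-nonzero (+ suc a) (λ ())) (begin
      ω (+ suc a) *F U j (suc a) j' i' j'' i''
        ≈⟨ FR.sym (contU j a j' i' j'' i'' bal) ⟩
      left-neighbour U j a j' i' j'' i'' +F tpowF (+ j'') *F centre-neighbour U j a j' i' j'' i''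
        ≈⟨ left j'' bal ⟨+⟩ (FR.refl ⟨*⟩ centre i' i'' bal) ⟩
      left-neighbour V j a j' i' j'' i'' +F tpowF (+ j'') *F centre-neighbour V j a j' i' j'' i''
        ≈⟨ contV j a j' i' j'' i'' bal ⟩
      ω (+ suc a) *F V j (suc a) j' i' j'' i'' ∎)
    where
    induction : ∀ i' j'' i'' → Balanced j a j' i' j'' i'' → U j a j' i' j'' i'' ≈F V j a j' i' j'' i''
    induction = contiguous-unique U V contU contV initial j a j'
    left : ∀ j'' → Balanced j (suc a) j' i' j'' i'' →
           left-neighbour U j a j' i' j'' i'' ≈F left-neighbour V j a j' i' j'' i''
    left zero    _ = FR.refl
    left (suc b) (balanced e₁ e₂ e₃) = induction i' b i'' (balanced e₁
      (ℕP.suc-injective (trans (sym (ℕP.+-suc i' b)) e₂)) (ℕP.suc-injective (trans (sym (ℕP.+-suc i'' b)) e₃)))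
    centre : ∀ i' i'' → Balanced j (suc a) j' i' j'' i'' →
             centre-neighbour U j a j' i' j'' i'' ≈F centre-neighbour V j a j' i' j'' i''
    centre zero    _       _ = FR.refl
    centre (suc p) zero    _ = FR.refl
    centre (suc p) (suc q) (balanced e₁ e₂ e₃) =
      induction p j'' q (balanced (ℕP.suc-injective e₁) (ℕP.suc-injective e₂) (ℕP.suc-injective e₃))

-- Step 2: u satisfies the contiguous relation.
module ContiguityOfU where
  open Polynomials
  open PolynomialDomain
  open Fractions
  open PowersAndSums
  open Phi
  open LiftOfU
  open TermExpansion
  open ContiguousRelation
  open +-*-Solver using ()
    renaming (solve to zsolve; _:+_ to _+'_; _:-_ to _-'_; _:=_ to _='_; con to ι)
  open FS using (solve; _:+_; _:*_; :-_; _:=_; con)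

  -- Termwise the difference D(n) of the two sides telescopes: D(n) = G(n+1) - G(n)
  -- with G(n) = (t^{i-n} - t^i) τ(j,i,j',i',j'',i'')(n).
  module ContiguityOfτ (j a j' i' j'' i'' : ℕ)
                       (i'j''≡ij : i' ℕ.+ j'' ≡ suc a ℕ.+ j) (i''j''≡ij' : i'' ℕ.+ j'' ≡ suc a ℕ.+ j') where

    private
      Zj Za Zi Zj' Zi' Zj'' Zi'' : ℤ
      Zj = + j
      Za = + a
      Zi = + suc a
      Zj' = + j'
      Zi' = + i'
      Zj'' = + j''
      Zi'' = + i''

    τ₊ τL τC : ℕ → F
    τ₊ = τ Zj Zi Zj' Zi' Zj'' Zi''
    τL = τ Zj Za Zj' Zi' (Zj'' ℤ.- + 1) Zi''
    τC = τ Zj Za Zj' (Zi' ℤ.- + 1) Zj'' (Zi'' ℤ.- + 1)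

    private
      h : F
      h = tpowF Zj''

      G D : ℕ → F
      G n = (tpowF (Zi ℤ.- + n) +F -F tpowF Zi) *F τ₊ n
      D n = τL n +F h *F τC n +F -F (ω Zi *F τ₊ n)

      module AtIndex (n : ℕ) (n≤a : n ≤ a) where
        S P Iₙ Iₑ If R common : F
        S  = σ Zj' n
        P  = φℤ (Za ℤ.+ Zj ℤ.- + n)
        Iₙ = φ⁻¹ (+ suc n)
        Iₑ = φ⁻¹ (Zi ℤ.- + n)
        If = φ⁻¹ (Zi' ℤ.- + n)
        R  = φ⁻¹ Zi'' *F φ⁻¹ Zj *F φ⁻¹ Zj''
        common = S *F P *F Iₙ *F Iₑ *F If *F R

        -- In the variables s = t^{n+1}, e = t^{i-n}, f = t^{i'-n}, g = t^{i''},
        -- h = t^{j''}, p = t^i and x = t^{j'+n+1}, each term is `common` times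
        -- a product of factors 1 - (monomial).
        s e f g p e₁ x ωs ωe ωf ωg ωh ωfh : F
        s = tpowF (+ suc n)
        e = tpowF (Zi ℤ.- + n)
        f = tpowF (Zi' ℤ.- + n)
        g = tpowF Zi''
        p = tpowF Zi
        e₁ = tpowF (Zi ℤ.- + suc n)
        x = tpowF (Zj' ℤ.+ + suc n)

        ωs = ω (+ suc n)
        ωe = ω (Zi ℤ.- + n)
        ωf = ω (Zi' ℤ.- + n)
        ωg = ω Zi''
        ωh = ω Zj''
        ωfh = ω (Zi ℤ.+ Zj ℤ.- + n)

        a-n : Za ℤ.- + n ≡ (Zi ℤ.- + n) ℤ.- + 1
        a-n = zsolve 2 (λ a n → a -' n =' ((ι (+ 1) +' a) -' n) -' ι (+ 1)) refl Za (+ n)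
        i'-1-n : (Zi' ℤ.- + 1) ℤ.- + n ≡ (Zi' ℤ.- + n) ℤ.- + 1
        i'-1-n = zsolve 2 (λ a n → (a -' ι (+ 1)) -' n =' (a -' n) -' ι (+ 1)) refl Zi' (+ n)
        a+j-n : Za ℤ.+ Zj ℤ.- + n ≡ (Zi ℤ.+ Zj ℤ.- + n) ℤ.- + 1
        a+j-n = zsolve 3 (λ a j n → a +' j -' n =' ((ι (+ 1) +' a) +' j -' n) -' ι (+ 1)) refl Za Zj (+ n)
        i+j-n : Zi ℤ.+ Zj ℤ.- + n ≡ + suc (a ℕ.+ j ℕ.∸ n)
        i+j-n = trans (ℤP.m-n≡m⊖n (suc a ℕ.+ j) n)
                  (trans (ℤP.⊖-≥ (ℕP.≤-trans (ℕP.m≤n⇒m≤1+n n≤a) (ℕP.m≤m+n (suc a) j)))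
                         (cong +_ (ℕP.+-∸-assoc 1 (ℕP.≤-trans n≤a (ℕP.m≤m+n a j)))))
        i+j-suc-n : Zi ℤ.+ Zj ℤ.- + suc n ≡ Za ℤ.+ Zj ℤ.- + n
        i+j-suc-n = zsolve 3 (λ a j n → (ι (+ 1) +' a) +' j -' (ι (+ 1) +' n) =' a +' j -' n) refl Za Zj (+ n)
        minus-suc-n : ∀ z → z ℤ.- + suc n ≡ (z ℤ.- + n) ℤ.- + 1
        minus-suc-n z = zsolve 2 (λ z n → z -' (ι (+ 1) +' n) =' (z -' n) -' ι (+ 1)) refl z (+ n)

        τL≈ : τL n ≈F common *F (ωs *F ωe *F ωh)
        τL≈ = begin
          S *F P *F φ⁻¹ (+ n) *F φ⁻¹ (Za ℤ.- + n) *F If *F (φ⁻¹ Zi'' *F φ⁻¹ Zj *F φ⁻¹ (Zj'' ℤ.- + 1))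
            ≈⟨ FR.refl ⟨*⟩ FR.refl ⟨*⟩ φ⁻¹-step' (+ suc n) (+ n) refl ⟨*⟩ φ⁻¹-step' _ _ a-n ⟨*⟩ FR.refl ⟨*⟩ (FR.refl ⟨*⟩ FR.refl ⟨*⟩ φ⁻¹-step Zj'') ⟩
          S *F P *F (Iₙ *F ωs) *F (Iₑ *F ωe) *F If *F (φ⁻¹ Zi'' *F φ⁻¹ Zj *F (φ⁻¹ Zj'' *F ωh))
            ≈⟨ solve 11 (λ S P Iₙ ωs Iₑ ωe If a b c ωh → S :* P :* (Iₙ :* ωs) :* (Iₑ :* ωe) :* If :* (a :* b :* (c :* ωh))
                  := S :* P :* Iₙ :* Iₑ :* If :* (a :* b :* c) :* (ωs :* ωe :* ωh))
                  FR.refl S P Iₙ ωs Iₑ ωe If (φ⁻¹ Zi'') (φ⁻¹ Zj) (φ⁻¹ Zj'') ωh ⟩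
          common *F (ωs *F ωe *F ωh) ∎

        τC≈ : τC n ≈F common *F (ωs *F ωe *F ωf *F ωg)
        τC≈ = begin
          S *F P *F φ⁻¹ (+ n) *F φ⁻¹ (Za ℤ.- + n) *F φ⁻¹ ((Zi' ℤ.- + 1) ℤ.- + n) *F (φ⁻¹ (Zi'' ℤ.- + 1) *F φ⁻¹ Zj *F φ⁻¹ Zj'')
            ≈⟨ FR.refl ⟨*⟩ FR.refl ⟨*⟩ φ⁻¹-step' (+ suc n) (+ n) refl ⟨*⟩ φ⁻¹-step' _ _ a-n ⟨*⟩ φ⁻¹-step' _ _ i'-1-n ⟨*⟩ (φ⁻¹-step Zi'' ⟨*⟩ FR.refl ⟨*⟩ FR.refl) ⟩
          S *F P *F (Iₙ *F ωs) *F (Iₑ *F ωe) *F (If *F ωf) *F (φ⁻¹ Zi'' *F ωg *F φ⁻¹ Zj *F φ⁻¹ Zj'')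
            ≈⟨ solve 12 (λ S P Iₙ ωs Iₑ ωe If ωf a ωg b c → S :* P :* (Iₙ :* ωs) :* (Iₑ :* ωe) :* (If :* ωf) :* (a :* ωg :* b :* c)
                  := S :* P :* Iₙ :* Iₑ :* If :* (a :* b :* c) :* (ωs :* ωe :* ωf :* ωg))
                  FR.refl S P Iₙ ωs Iₑ ωe If ωf (φ⁻¹ Zi'') ωg (φ⁻¹ Zj) (φ⁻¹ Zj'') ⟩
          common *F (ωs *F ωe *F ωf *F ωg) ∎

        τ₊≈ : τ₊ n ≈F common *F (ωfh *F ωs)
        τ₊≈ = begin
          S *F φℤ (Zi ℤ.+ Zj ℤ.- + n) *F φ⁻¹ (+ n) *F Iₑ *F If *F R
            ≈⟨ FR.refl ⟨*⟩ φℤ-step _ _ _ i+j-n a+j-n ⟨*⟩ φ⁻¹-step' (+ suc n) (+ n) refl ⟨*⟩ FR.refl ⟨*⟩ FR.refl ⟨*⟩ FR.refl ⟩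
          S *F (P *F ωfh) *F (Iₙ *F ωs) *F Iₑ *F If *F R
            ≈⟨ solve 8 (λ S P ωfh Iₙ ωs Iₑ If R → S :* (P :* ωfh) :* (Iₙ :* ωs) :* Iₑ :* If :* R := S :* P :* Iₙ :* Iₑ :* If :* R :* (ωfh :* ωs)) FR.refl S P ωfh Iₙ ωs Iₑ If R ⟩
          common *F (ωfh *F ωs) ∎

        τ₊-next≈ : τ₊ (suc n) ≈F common *F (-F x *F ωe *F ωf)
        τ₊-next≈ = begin
          S *F -F x *F φℤ (Zi ℤ.+ Zj ℤ.- + suc n) *F Iₙ *F φ⁻¹ (Zi ℤ.- + suc n) *F φ⁻¹ (Zi' ℤ.- + suc n) *F R
            ≈⟨ FR.refl ⟨*⟩ FR.refl ⟨*⟩ ≈F-reflexive (cong φℤ i+j-suc-n) ⟨*⟩ FR.refl ⟨*⟩ φ⁻¹-step' _ _ (minus-suc-n Zi) ⟨*⟩ φ⁻¹-step' _ _ (minus-suc-n Zi') ⟨*⟩ FR.refl ⟩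
          S *F -F x *F P *F Iₙ *F (Iₑ *F ωe) *F (If *F ωf) *F R
            ≈⟨ solve 9 (λ S x P Iₙ Iₑ ωe If ωf R → S :* (:- x) :* P :* Iₙ :* (Iₑ :* ωe) :* (If :* ωf) :* R := S :* P :* Iₙ :* Iₑ :* If :* R :* (:- x :* ωe :* ωf)) FR.refl S x P Iₙ Iₑ ωe If ωf R ⟩
          common *F (-F x *F ωe *F ωf) ∎

        ωfh≈ : ωfh ≈F 1F +F -F (f *F h)
        ωfh≈ = FR.trans (ω≈ _) (FR.refl ⟨+⟩ FR.-‿cong (FR.trans (tpow-cong exponent) (tpow-+ _ _)))
          where
          exponent : Zi ℤ.+ Zj ℤ.- + n ≡ (Zi' ℤ.- + n) ℤ.+ Zj''
          exponent = trans (cong (ℤ._- + n) (sym (cong +_ i'j''≡ij)))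
                           (zsolve 3 (λ a b n → a +' b -' n =' (a -' n) +' b) refl Zi' Zj'' (+ n))

        e₁x≈gh : e₁ *F x ≈F g *F h
        e₁x≈gh = FR.trans (FR.sym (tpow-+ _ _)) (FR.trans (tpow-cong exponent) (tpow-+ _ _))
          where
          exponent : (Zi ℤ.- + suc n) ℤ.+ (Zj' ℤ.+ + suc n) ≡ Zi'' ℤ.+ Zj''
          exponent = trans (zsolve 3 (λ i j' n → (i -' n) +' (j' +' n) =' i +' j') refl Zi Zj' (+ suc n))
                           (sym (cong +_ i''j''≡ij'))

        px≈ghs : p *F x ≈F g *F h *F s
        px≈ghs = FR.trans (FR.sym (tpow-+ _ _)) (FR.trans (tpow-cong exponent) (FR.trans (tpow-+ _ _) (tpow-+ _ _ ⟨*⟩ FR.refl)))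
          where
          exponent : Zi ℤ.+ (Zj' ℤ.+ + suc n) ≡ (Zi'' ℤ.+ Zj'') ℤ.+ + suc n
          exponent = trans (zsolve 3 (λ i j' n → i +' (j' +' n) =' (i +' j') +' n) refl Zi Zj' (+ suc n))
                           (cong (ℤ._+ + suc n) (sym (cong +_ i''j''≡ij')))

        -- Both D(n) and G(n+1) - G(n) equal `common` times this expression.
        N : F
        N = common *F (-F (g *F h +F -F (g *F h *F s)) *F (1F +F -F e) *F (1F +F -F f)
                       +F -F ((e +F -F p) *F (1F +F -F (f *F h)) *F (1F +F -F s)))

        D≈N : D n ≈F N
        D≈N = begin
          τL n +F h *F τC n +F -F (ω Zi *F τ₊ n)
            ≈⟨ τL≈ ⟨+⟩ (FR.refl ⟨*⟩ τC≈) ⟨+⟩ FR.-‿cong (FR.refl ⟨*⟩ τ₊≈) ⟩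
          common *F (ωs *F ωe *F ωh) +F h *F (common *F (ωs *F ωe *F ωf *F ωg)) +F -F (ω Zi *F (common *F (ωfh *F ωs)))
            ≈⟨ (FR.refl ⟨*⟩ (ω≈ _ ⟨*⟩ ω≈ _ ⟨*⟩ ω≈ _)) ⟨+⟩ (FR.refl ⟨*⟩ (FR.refl ⟨*⟩ (ω≈ _ ⟨*⟩ ω≈ _ ⟨*⟩ ω≈ _ ⟨*⟩ ω≈ _)))
               ⟨+⟩ FR.-‿cong (ω≈ _ ⟨*⟩ (FR.refl ⟨*⟩ (ωfh≈ ⟨*⟩ ω≈ _))) ⟩
          common *F ((1F +F -F s) *F (1F +F -F e) *F (1F +F -F h))
            +F h *F (common *F ((1F +F -F s) *F (1F +F -F e) *F (1F +F -F f) *F (1F +F -F g)))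
            +F -F ((1F +F -F p) *F (common *F ((1F +F -F (f *F h)) *F (1F +F -F s))))
            ≈⟨ solve 7 (λ b s e f g h p →
                 b :* ((con (+ 1) :+ :- s) :* (con (+ 1) :+ :- e) :* (con (+ 1) :+ :- h))
                   :+ h :* (b :* ((con (+ 1) :+ :- s) :* (con (+ 1) :+ :- e) :* (con (+ 1) :+ :- f) :* (con (+ 1) :+ :- g)))
                   :+ :- ((con (+ 1) :+ :- p) :* (b :* ((con (+ 1) :+ :- (f :* h)) :* (con (+ 1) :+ :- s))))
                 := b :* (:- (g :* h :+ :- (g :* h :* s)) :* (con (+ 1) :+ :- e) :* (con (+ 1) :+ :- f)
                          :+ :- ((e :+ :- p) :* (con (+ 1) :+ :- (f :* h)) :* (con (+ 1) :+ :- s))))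
                 FR.refl common s e f g h p ⟩
          N ∎

        G-step≈N : G (suc n) +F -F G n ≈F N
        G-step≈N = begin
          (e₁ +F -F p) *F τ₊ (suc n) +F -F ((e +F -F p) *F τ₊ n)
            ≈⟨ (FR.refl ⟨*⟩ τ₊-next≈) ⟨+⟩ FR.-‿cong (FR.refl ⟨*⟩ τ₊≈) ⟩
          (e₁ +F -F p) *F (common *F (-F x *F ωe *F ωf)) +F -F ((e +F -F p) *F (common *F (ωfh *F ωs)))
            ≈⟨ solve 9 (λ e₁ p b x ωe ωf e ωfh ωs → (e₁ :+ :- p) :* (b :* (:- x :* ωe :* ωf)) :+ :- ((e :+ :- p) :* (b :* (ωfh :* ωs)))
                  := b :* (:- (e₁ :* x :+ :- (p :* x)) :* ωe :* ωf :+ :- ((e :+ :- p) :* ωfh :* ωs)))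
                  FR.refl e₁ p common x ωe ωf e ωfh ωs ⟩
          common *F (-F (e₁ *F x +F -F (p *F x)) *F ωe *F ωf +F -F ((e +F -F p) *F ωfh *F ωs))
            ≈⟨ FR.refl ⟨*⟩ (FR.-‿cong (e₁x≈gh ⟨+⟩ FR.-‿cong px≈ghs) ⟨*⟩ ω≈ _ ⟨*⟩ ω≈ _ ⟨+⟩ FR.-‿cong (FR.refl ⟨*⟩ ωfh≈ ⟨*⟩ ω≈ _)) ⟩
          N ∎

        telescoping : D n ≈F G (suc n) +F -F G n
        telescoping = FR.trans D≈N (FR.sym G-step≈N)

      -- the boundary terms: τL and τC vanish at n = a + 1 (1/φ_{a-n} = 0),
      -- G(0) = 0 and G(a+1) = (1 - t^i) τ₊(a+1).
      τL-last : τL (suc a) ≈F 0F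
      τL-last = FR.trans (FR.refl ⟨*⟩ φ⁻¹-below a (suc a) (ℕP.n<1+n a) ⟨*⟩ FR.refl ⟨*⟩ FR.refl)
                         (solve 3 (λ x y z → x :* con (+ 0) :* y :* z := con (+ 0)) FR.refl _ _ _)

      τC-last : τC (suc a) ≈F 0F
      τC-last = FR.trans (FR.refl ⟨*⟩ φ⁻¹-below a (suc a) (ℕP.n<1+n a) ⟨*⟩ FR.refl ⟨*⟩ FR.refl)
                         (solve 3 (λ x y z → x :* con (+ 0) :* y :* z := con (+ 0)) FR.refl _ _ _)

      G-first : G 0 ≈F 0F
      G-first = FR.trans ((tpow-cong (ℤP.+-identityʳ Zi) ⟨+⟩ FR.refl) ⟨*⟩ FR.refl)
                         (FR.trans (FR.-‿inverseʳ _ ⟨*⟩ FR.refl) (FR.zeroˡ _))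

      G-last : G (suc a) ≈F ω Zi *F τ₊ (suc a)
      G-last = FR.trans ((FR.trans (tpow-cong (ℤP.+-inverseʳ Zi)) tpow-0 ⟨+⟩ FR.refl) ⟨*⟩ FR.refl) (FR.sym (ω≈ Zi) ⟨*⟩ FR.refl)

      K : ℕ
      K = suc (suc a)

      sum-D : sumF K D ≈F 0F
      sum-D = begin
        sumF (suc a) D +F D (suc a)
          ≈⟨ FR.trans (sum-cong (suc a) (λ n n<sa → AtIndex.telescoping n (ℕP.≤-pred n<sa))) (telescope (suc a) G)
             ⟨+⟩ ((τL-last ⟨+⟩ (FR.refl ⟨*⟩ τC-last)) ⟨+⟩ FR.refl) ⟩
        (G (suc a) +F -F G 0) +F (0F +F h *F 0F +F -F (ω Zi *F τ₊ (suc a)))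
          ≈⟨ (G-last ⟨+⟩ FR.-‿cong G-first) ⟨+⟩ FR.refl ⟩
        (ω Zi *F τ₊ (suc a) +F -F 0F) +F (0F +F h *F 0F +F -F (ω Zi *F τ₊ (suc a)))
          ≈⟨ solve 2 (λ q h → (q :+ :- con (+ 0)) :+ (con (+ 0) :+ h :* con (+ 0) :+ :- q) := con (+ 0)) FR.refl _ h ⟩
        0F ∎

    τ-contiguous : sumF K τL +F h *F sumF K τC ≈F ω Zi *F sumF K τ₊
    τ-contiguous = begin
      sumF K τL +F h *F sumF K τC
        ≈⟨ solve 3 (λ l c x → l :+ c := (l :+ c :+ :- x) :+ x) FR.refl _ _ _ ⟩
      (sumF K τL +F h *F sumF K τC +F -F (ω Zi *F sumF K τ₊)) +F ω Zi *F sumF K τ₊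
        ≈⟨ (FR.refl ⟨+⟩ sum-*ˡ K h τC ⟨+⟩ FR.trans (solve 2 (λ o s → :- (o :* s) := (:- o) :* s) FR.refl _ _) (sum-*ˡ K (-F ω Zi) τ₊)) ⟨+⟩ FR.refl ⟩
      (sumF K τL +F sumF K (λ n → h *F τC n) +F sumF K (λ n → -F ω Zi *F τ₊ n)) +F ω Zi *F sumF K τ₊
        ≈⟨ FR.trans (FR.sym (sum-+ K _ _) ⟨+⟩ FR.refl) (FR.sym (sum-+ K _ _)) ⟨+⟩ FR.refl ⟩
      sumF K (λ n → τL n +F h *F τC n +F -F ω Zi *F τ₊ n) +F ω Zi *F sumF K τ₊
        ≈⟨ FR.trans (sum-cong K (λ n _ → FR.refl ⟨+⟩ solve 2 (λ o t → (:- o) :* t := :- (o :* t)) FR.refl _ _)) sum-D ⟨+⟩ FR.refl ⟩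
      0F +F ω Zi *F sumF K τ₊
        ≈⟨ FR.+-identityˡ _ ⟩
      ω Zi *F sumF K τ₊ ∎

  u-contiguous : Contiguous uF
  u-contiguous j a j' i' j'' i'' (balanced i''j≡i'j' i'j''≡ij i''j''≡ij') = begin
    left-neighbour uF j a j' i' j'' i'' +F tpowF (+ j'') *F centre-neighbour uF j a j' i' j'' i''
      ≈⟨ left j'' ⟨+⟩ (FR.refl ⟨*⟩ centre i' i'' i''j≡i'j') ⟩
    sumF K (τ (+ j) (+ a) (+ j') (+ i') (+ j'' ℤ.- + 1) (+ i''))
      +F tpowF (+ j'') *F sumF K (τ (+ j) (+ a) (+ j') (+ i' ℤ.- + 1) (+ j'') (+ i'' ℤ.- + 1))
      ≈⟨ ContiguityOfτ.τ-contiguous j a j' i' j'' i'' i'j''≡ij i''j''≡ij' ⟩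
    ω (+ suc a) *F sumF K (τ (+ j) (+ suc a) (+ j') (+ i') (+ j'') (+ i''))
      ≈⟨ FR.refl ⟨*⟩ FR.sym (Expansion.expansion j (suc a) j' i' j'' i'' i''j≡i'j' K (s≤s (ℕP.m⊓n≤m (suc a) i'))) ⟩
    ω (+ suc a) *F uF j (suc a) j' i' j'' i'' ∎
    where
    K : ℕ
    K = suc (suc a)
    range : ∀ i' → suc (a ⊓ i') ≤ K
    range i' = s≤s (ℕP.m≤n⇒m≤1+n (ℕP.m⊓n≤m a i'))
    -- a neighbour that leaves the range of u is 0, and so is each term of
    -- its τ-sum, through a factor 1/φ_{-1-n}
    left : ∀ j'' → left-neighbour uF j a j' i' j'' i'' ≈F sumF K (τ (+ j) (+ a) (+ j') (+ i') (+ j'' ℤ.- + 1) (+ i''))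
    left zero    = FR.sym (sum-zero K _ (λ n _ → FR.trans (FR.refl ⟨*⟩ FR.zeroʳ _) (FR.zeroʳ _)))
    left (suc b) = Expansion.expansion j a j' i' b i'' i''j≡i'j' K (range i')
    centre : ∀ i' i'' → i'' ℕ.+ j ≡ i' ℕ.+ j' →
             centre-neighbour uF j a j' i' j'' i'' ≈F sumF K (τ (+ j) (+ a) (+ j') (+ i' ℤ.- + 1) (+ j'') (+ i'' ℤ.- + 1))
    centre zero    i''     _ = FR.sym (sum-zero K _ (λ n _ → FR.trans (FR.refl ⟨*⟩ φ⁻¹-below-zero n ⟨*⟩ FR.refl) (FR.trans (FR.zeroʳ _ ⟨*⟩ FR.refl) (FR.zeroˡ _))))
    centre (suc p) zero    _ = FR.sym (sum-zero K _ (λ n _ → FR.trans (FR.refl ⟨*⟩ FR.trans (FR.zeroˡ _ ⟨*⟩ FR.refl) (FR.zeroˡ _)) (FR.zeroʳ _)))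
    centre (suc p) (suc q) e = Expansion.expansion j a j' p j'' q (ℕP.suc-injective e) K (range p)

module SymmetricSum where
  open Polynomials
  open PolynomialDomain
  open Fractions
  open PowersAndSums
  open Phi
  open +-*-Solver using ()
    renaming (solve to zsolve; _:+_ to _+'_; _:*_ to _*'_; :-_ to -'_; _:-_ to _-'_; _:=_ to _='_; con to ι)
  open FS using (solve; _:+_; _:*_; :-_; _:=_; con)

  -- The manifestly symmetric form of u:
  --   Θ(j, j', j''; d) = Σ_k t^{k(k+d)} / (φ_k φ_{k+d} φ_{j-k} φ_{j'-k} φ_{j''-k}),
  -- visibly symmetric in j, j', j'' and, after a shift of the summation
  -- index, invariant under (j, j', j'', d) ↦ (j+d, j'+d, j''+d, -d).
  θ : ℤ → ℤ → ℤ → ℤ → ℕ → F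
  θ j j' j'' d k = tpowF (+ k ℤ.* (+ k ℤ.+ d)) *F φ⁻¹ (+ k) *F φ⁻¹ (+ k ℤ.+ d)
                   *F φ⁻¹ (j ℤ.- + k) *F φ⁻¹ (j' ℤ.- + k) *F φ⁻¹ (j'' ℤ.- + k)

  Θ : ℕ → ℤ → ℤ → ℤ → ℤ → F
  Θ K j j' j'' d = sumF K (θ j j' j'' d)

  θ-vanishes-j : ∀ J j' j'' d k → J < k → θ (+ J) j' j'' d k ≈F 0F
  θ-vanishes-j J j' j'' d k J<k =
    FR.trans (FR.refl ⟨*⟩ φ⁻¹-below J k J<k ⟨*⟩ FR.refl ⟨*⟩ FR.refl)
             (solve 3 (λ a b c → a :* con (+ 0) :* b :* c := con (+ 0)) FR.refl _ _ _)

  θ-vanishes-j' : ∀ j J j'' d k → J < k → θ j (+ J) j'' d k ≈F 0F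
  θ-vanishes-j' j J j'' d k J<k =
    FR.trans (FR.refl ⟨*⟩ φ⁻¹-below J k J<k ⟨*⟩ FR.refl)
             (solve 2 (λ a b → a :* con (+ 0) :* b := con (+ 0)) FR.refl _ _)

  θ-vanishes-j'' : ∀ j j' J d k → J < k → θ j j' (+ J) d k ≈F 0F
  θ-vanishes-j'' j j' J d k J<k = FR.trans (FR.refl ⟨*⟩ φ⁻¹-below J k J<k) (FR.zeroʳ _)

  θ-vanishes-d : ∀ j j' j'' d k m → + k ℤ.+ d ≡ -[1+ m ] → θ j j' j'' d k ≈F 0F
  θ-vanishes-d j j' j'' d k m k+d<0 =
    FR.trans (FR.refl ⟨*⟩ ≈F-reflexive (cong φ⁻¹ k+d<0) ⟨*⟩ FR.refl ⟨*⟩ FR.refl ⟨*⟩ FR.refl)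
             (solve 5 (λ a b c d e → a :* con (+ 0) :* b :* c :* d := con (+ 0)) FR.refl _ _ _ _ (θ j j' j'' d k))

  Θ-range : ∀ J K j' j'' d → suc J ≤ K → Θ K (+ J) j' j'' d ≈F Θ (suc J) (+ J) j' j'' d
  Θ-range J K j' j'' d J<K = sum-extend (suc J) K _ (λ k J<k → θ-vanishes-j J j' j'' d k J<k) J<K

  θ-contiguous : ∀ j j' j'' d k →
    θ j j' (j'' ℤ.- + 1) d k +F tpowF j'' *F θ j j' j'' (d ℤ.- + 1) k ≈F ω (j'' ℤ.+ d) *F θ j j' j'' d k
  θ-contiguous j j' j'' d k = begin
    E *F Iₖ *F Iₖ₊d₋₁ *F Iⱼ *F Iⱼ' *F φ⁻¹ ((j'' ℤ.- + 1) ℤ.- + k)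
      +F tpowF j'' *F (tpowF (+ k ℤ.* (+ k ℤ.+ (d ℤ.- + 1))) *F Iₖ *F φ⁻¹ (+ k ℤ.+ (d ℤ.- + 1)) *F Iⱼ *F Iⱼ' *F Iⱼ'')
      ≈⟨ (FR.refl ⟨*⟩ φ⁻¹-step' _ _ j''-1-k)
         ⟨+⟩ (FR.refl ⟨*⟩ (FR.trans (tpow-cong exponent) (tpow-+ _ _) ⟨*⟩ FR.refl ⟨*⟩ φ⁻¹-step' _ _ k+d-1 ⟨*⟩ FR.refl ⟨*⟩ FR.refl ⟨*⟩ FR.refl)) ⟩
    E *F Iₖ *F Iₖ₊d₋₁ *F Iⱼ *F Iⱼ' *F (Iⱼ'' *F ω (j'' ℤ.- + k))
      +F tpowF j'' *F (E *F tpowF (ℤ.- + k) *F Iₖ *F (Iₖ₊d₋₁ *F ω (+ k ℤ.+ d)) *F Iⱼ *F Iⱼ' *F Iⱼ'')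
      ≈⟨ solve 10 (λ E Iₖ Id Iⱼ Iⱼ' Iⱼ'' o₁ h t o₂ → E :* Iₖ :* Id :* Iⱼ :* Iⱼ' :* (Iⱼ'' :* o₁) :+ h :* (E :* t :* Iₖ :* (Id :* o₂) :* Iⱼ :* Iⱼ' :* Iⱼ'')
            := (o₁ :+ (h :* t) :* o₂) :* (E :* Iₖ :* Id :* Iⱼ :* Iⱼ' :* Iⱼ''))
            FR.refl E Iₖ Iₖ₊d₋₁ Iⱼ Iⱼ' Iⱼ'' (ω (j'' ℤ.- + k)) (tpowF j'') (tpowF (ℤ.- + k)) (ω (+ k ℤ.+ d)) ⟩
    (ω (j'' ℤ.- + k) +F (tpowF j'' *F tpowF (ℤ.- + k)) *F ω (+ k ℤ.+ d)) *F θ j j' j'' d k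
      ≈⟨ (ω≈ _ ⟨+⟩ (FR.sym (tpow-+ _ _) ⟨*⟩ ω≈ _)) ⟨*⟩ FR.refl ⟩
    (1F +F -F A +F A *F (1F +F -F B)) *F θ j j' j'' d k
      ≈⟨ solve 3 (λ A B t → (con (+ 1) :+ :- A :+ A :* (con (+ 1) :+ :- B)) :* t := (con (+ 1) :+ :- (A :* B)) :* t) FR.refl A B _ ⟩
    (1F +F -F (A *F B)) *F θ j j' j'' d k
      ≈⟨ (FR.refl ⟨+⟩ FR.-‿cong (FR.trans (FR.sym (tpow-+ _ _)) (tpow-cong j''+d))) ⟨*⟩ FR.refl ⟩
    (1F +F -F tpowF (j'' ℤ.+ d)) *F θ j j' j'' d k
      ≈⟨ FR.sym (ω≈ _) ⟨*⟩ FR.refl ⟩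
    ω (j'' ℤ.+ d) *F θ j j' j'' d k ∎
    where
    E Iₖ Iₖ₊d₋₁ Iⱼ Iⱼ' Iⱼ'' A B : F
    E       = tpowF (+ k ℤ.* (+ k ℤ.+ d))
    Iₖ      = φ⁻¹ (+ k)
    Iₖ₊d₋₁  = φ⁻¹ (+ k ℤ.+ d)
    Iⱼ      = φ⁻¹ (j ℤ.- + k)
    Iⱼ'     = φ⁻¹ (j' ℤ.- + k)
    Iⱼ''    = φ⁻¹ (j'' ℤ.- + k)
    A       = tpowF (j'' ℤ.- + k)
    B       = tpowF (+ k ℤ.+ d)
    j''-1-k : (j'' ℤ.- + 1) ℤ.- + k ≡ (j'' ℤ.- + k) ℤ.- + 1
    j''-1-k = zsolve 2 (λ a k → (a -' ι (+ 1)) -' k =' (a -' k) -' ι (+ 1)) refl j'' (+ k)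
    k+d-1 : + k ℤ.+ (d ℤ.- + 1) ≡ (+ k ℤ.+ d) ℤ.- + 1
    k+d-1 = zsolve 2 (λ k d → k +' (d -' ι (+ 1)) =' (k +' d) -' ι (+ 1)) refl (+ k) d
    exponent : + k ℤ.* (+ k ℤ.+ (d ℤ.- + 1)) ≡ + k ℤ.* (+ k ℤ.+ d) ℤ.+ ℤ.- + k
    exponent = zsolve 2 (λ k d → k *' (k +' (d -' ι (+ 1))) =' k *' (k +' d) +' -' k) refl (+ k) d
    j''+d : (j'' ℤ.- + k) ℤ.+ (+ k ℤ.+ d) ≡ j'' ℤ.+ d
    j''+d = zsolve 3 (λ a k d → (a -' k) +' (k +' d) =' a +' d) refl j'' (+ k) d

  Θ-contiguous : ∀ K j j' j'' d →
    Θ K j j' (j'' ℤ.- + 1) d +F tpowF j'' *F Θ K j j' j'' (d ℤ.- + 1) ≈F ω (j'' ℤ.+ d) *F Θ K j j' j'' d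
  Θ-contiguous K j j' j'' d = begin
    Θ K j j' (j'' ℤ.- + 1) d +F tpowF j'' *F Θ K j j' j'' (d ℤ.- + 1)
      ≈⟨ FR.refl ⟨+⟩ sum-*ˡ K _ _ ⟩
    Θ K j j' (j'' ℤ.- + 1) d +F sumF K (λ k → tpowF j'' *F θ j j' j'' (d ℤ.- + 1) k)
      ≈⟨ FR.sym (sum-+ K _ _) ⟩
    sumF K (λ k → θ j j' (j'' ℤ.- + 1) d k +F tpowF j'' *F θ j j' j'' (d ℤ.- + 1) k)
      ≈⟨ sum-cong K (λ k _ → θ-contiguous j j' j'' d k) ⟩
    sumF K (λ k → ω (j'' ℤ.+ d) *F θ j j' j'' d k)
      ≈⟨ FR.sym (sum-*ˡ K _ _) ⟩
    ω (j'' ℤ.+ d) *F Θ K j j' j'' d ∎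

  Θ-swap : ∀ K j j' j'' d → Θ K j j' j'' d ≈F Θ K j j'' j' d
  Θ-swap K j j' j'' d = sum-cong K (λ k _ →
    solve 6 (λ e p q x y z → e :* p :* q :* x :* y :* z := e :* p :* q :* x :* z :* y) FR.refl _ _ _ _ _ _)

  -- Cyclic symmetry in (j, j', j''), summing over the common range
  -- 0 .. max(j, j', j'') in between.
  Θ-cyclic : ∀ a b c d → Θ (suc a) (+ a) (+ b) (+ c) d ≈F Θ (suc b) (+ b) (+ c) (+ a) d
  Θ-cyclic a b c d = begin
    Θ (suc a) (+ a) (+ b) (+ c) d  ≈⟨ FR.sym (Θ-range a M (+ b) (+ c) d a<M) ⟩
    Θ M (+ a) (+ b) (+ c) d        ≈⟨ sum-cong M (λ k _ → solve 6 (λ e p q x y z → e :* p :* q :* x :* y :* z := e :* p :* q :* y :* z :* x) FR.refl _ _ _ _ _ _) ⟩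
    Θ M (+ b) (+ c) (+ a) d        ≈⟨ Θ-range b M (+ c) (+ a) d b<M ⟩
    Θ (suc b) (+ b) (+ c) (+ a) d  ∎
    where
    M : ℕ
    M = suc (a ⊔ b ⊔ c)
    a<M : suc a ≤ M
    a<M = s≤s (ℕP.≤-trans (ℕP.m≤m⊔n a b) (ℕP.m≤m⊔n (a ⊔ b) c))
    b<M : suc b ≤ M
    b<M = s≤s (ℕP.≤-trans (ℕP.m≤n⊔m a b) (ℕP.m≤m⊔n (a ⊔ b) c))

  -- Θ(j+D, j'+D, j''+D; -D) = Θ(j, j', j''; D): shift the index k ↦ k + D;
  -- the first D terms vanish since k - D < 0.
  Θ-shift : ∀ j j' j'' D →
    Θ (suc (j ℕ.+ D)) (+ (j ℕ.+ D)) (+ (j' ℕ.+ D)) (+ (j'' ℕ.+ D)) (ℤ.- + D) ≈F Θ (suc j) (+ j) (+ j') (+ j'') (+ D)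
  Θ-shift j j' j'' D = begin
    sumF (suc (j ℕ.+ D)) θ'                              ≈⟨ ≈F-reflexive (cong (λ n → sumF n θ') range) ⟩
    sumF (D ℕ.+ suc j) θ'                                ≈⟨ sum-split D (suc j) θ' ⟩
    sumF D θ' +F sumF (suc j) (λ k → θ' (D ℕ.+ k))       ≈⟨ sum-zero D θ' below-D ⟨+⟩ sum-cong (suc j) (λ k _ → shifted k) ⟩
    0F +F Θ (suc j) (+ j) (+ j') (+ j'') (+ D)           ≈⟨ FR.+-identityˡ _ ⟩
    Θ (suc j) (+ j) (+ j') (+ j'') (+ D)                 ∎
    where
    θ' : ℕ → F
    θ' = θ (+ (j ℕ.+ D)) (+ (j' ℕ.+ D)) (+ (j'' ℕ.+ D)) (ℤ.- + D)
    range : suc (j ℕ.+ D) ≡ D ℕ.+ suc j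
    range = trans (cong suc (ℕP.+-comm j D)) (sym (ℕP.+-suc D j))
    below-D : ∀ k → k < D → θ' k ≈F 0F
    below-D k k<D with negative-difference k D k<D
    ... | m , k-D<0 = θ-vanishes-d (+ (j ℕ.+ D)) (+ (j' ℕ.+ D)) (+ (j'' ℕ.+ D)) (ℤ.- + D) k m k-D<0
    difference : ∀ a k → + (a ℕ.+ D) ℤ.- + (D ℕ.+ k) ≡ + a ℤ.- + k
    difference a k = zsolve 3 (λ a d k → (a +' d) -' (d +' k) =' a -' k) refl (+ a) (+ D) (+ k)
    shifted : ∀ k → θ' (D ℕ.+ k) ≈F θ (+ j) (+ j') (+ j'') (+ D) k
    shifted k = begin
      θ' (D ℕ.+ k)
        ≈⟨ tpow-cong exponent ⟨*⟩ ≈F-reflexive (cong φ⁻¹ (cong +_ (ℕP.+-comm D k)))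
           ⟨*⟩ ≈F-reflexive (cong φ⁻¹ (zsolve 2 (λ d k → (d +' k) +' -' d =' k) refl (+ D) (+ k)))
           ⟨*⟩ ≈F-reflexive (cong φ⁻¹ (difference j k)) ⟨*⟩ ≈F-reflexive (cong φ⁻¹ (difference j' k))
           ⟨*⟩ ≈F-reflexive (cong φ⁻¹ (difference j'' k)) ⟩
      tpowF (+ k ℤ.* (+ k ℤ.+ + D)) *F φ⁻¹ (+ k ℤ.+ + D) *F φ⁻¹ (+ k) *F φ⁻¹ (+ j ℤ.- + k) *F φ⁻¹ (+ j' ℤ.- + k) *F φ⁻¹ (+ j'' ℤ.- + k)
        ≈⟨ solve 6 (λ e p q a b c → e :* p :* q :* a :* b :* c := e :* q :* p :* a :* b :* c) FR.refl _ _ _ _ _ _ ⟩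
      θ (+ j) (+ j') (+ j'') (+ D) k ∎
      where
      exponent : + (D ℕ.+ k) ℤ.* (+ (D ℕ.+ k) ℤ.+ ℤ.- + D) ≡ + k ℤ.* (+ k ℤ.+ + D)
      exponent = zsolve 2 (λ d k → (d +' k) *' ((d +' k) +' -' d) =' k *' (k +' d)) refl (+ D) (+ k)

-- Step 3: u = T on balanced hexagons, and the symmetries of T.
module Identification where
  open Polynomials
  open PolynomialDomain
  open Fractions
  open PowersAndSums
  open Phi
  open LiftOfU
  open TermExpansion
  open ContiguousRelation
  open ContiguityOfU
  open SymmetricSum
  open +-*-Solver using ()
    renaming (solve to zsolve; _:+_ to _+'_; _:*_ to _*'_; :-_ to -'_; _:-_ to _-'_; _:=_ to _='_; con to ι)
  open FS using (solve; _:+_; _:*_; _:=_; con)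

  T : Hexagonal
  T j i j' i' j'' i'' = Θ (suc j) (+ j) (+ j') (+ j'') (+ i ℤ.- + j'')

  T-contiguous : Contiguous T
  T-contiguous j a j' i' j'' i'' (balanced _ i'j''≡ij i''j''≡ij') = begin
    left-neighbour T j a j' i' j'' i'' +F tpowF (+ j'') *F centre-neighbour T j a j' i' j'' i''
      ≈⟨ left j'' ⟨+⟩ (FR.refl ⟨*⟩ centre i' i'' i'j''≡ij i''j''≡ij') ⟩
    Θ (suc j) (+ j) (+ j') (+ j'' ℤ.- + 1) d +F tpowF (+ j'') *F Θ (suc j) (+ j) (+ j') (+ j'') (d ℤ.- + 1)
      ≈⟨ Θ-contiguous (suc j) (+ j) (+ j') (+ j'') d ⟩
    ω (+ j'' ℤ.+ d) *F T j (suc a) j' i' j'' i''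
      ≈⟨ ≈F-reflexive (cong ω (zsolve 2 (λ b a → b +' (a -' b) =' a) refl (+ j'') (+ suc a))) ⟨*⟩ FR.refl ⟩
    ω (+ suc a) *F T j (suc a) j' i' j'' i'' ∎
    where
    d : ℤ
    d = + suc a ℤ.- + j''
    left : ∀ j'' → left-neighbour T j a j' i' j'' i'' ≈F Θ (suc j) (+ j) (+ j') (+ j'' ℤ.- + 1) (+ suc a ℤ.- + j'')
    left zero    = FR.sym (sum-zero (suc j) _ (λ k _ → FR.trans (FR.refl ⟨*⟩ φ⁻¹-below-zero k) (FR.zeroʳ _)))
    left (suc b) = ≈F-reflexive (cong (Θ (suc j) (+ j) (+ j') (+ b)) (zsolve 2 (λ a b → a -' b =' (ι (+ 1) +' a) -' (ι (+ 1) +' b)) refl (+ a) (+ b)))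
    negative : ∀ k J → k < suc J → j'' ≡ suc a ℕ.+ J → ∃ λ m → + k ℤ.+ (d ℤ.- + 1) ≡ -[1+ m ]
    negative k J k≤J refl with negative-difference k (suc J) k≤J
    ... | m , k-J-1<0 = m , trans (zsolve 3 (λ k a J → k +' (((ι (+ 1) +' a) -' ((ι (+ 1) +' a) +' J)) -' ι (+ 1)) =' k -' (ι (+ 1) +' J)) refl (+ k) (+ a) (+ J)) k-J-1<0
    centre : ∀ i' i'' → i' ℕ.+ j'' ≡ suc a ℕ.+ j → i'' ℕ.+ j'' ≡ suc a ℕ.+ j' →
             centre-neighbour T j a j' i' j'' i'' ≈F Θ (suc j) (+ j) (+ j') (+ j'') (d ℤ.- + 1)
    centre (suc p) (suc q) _ _ = ≈F-reflexive (cong (Θ (suc j) (+ j) (+ j') (+ j''))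
      (zsolve 2 (λ a b → a -' b =' ((ι (+ 1) +' a) -' b) -' ι (+ 1)) refl (+ a) (+ j'')))
    centre zero i'' j''≡ij _ = FR.sym (sum-zero (suc j) _ λ k k≤j →
      let (m , k+d-1<0) = negative k j k≤j j''≡ij in θ-vanishes-d (+ j) (+ j') (+ j'') (d ℤ.- + 1) k m k+d-1<0)
    centre (suc p) zero _ j''≡ij' = FR.sym (sum-zero (suc j) _ λ k _ → vanishes k)
      where
      vanishes : ∀ k → θ (+ j) (+ j') (+ j'') (d ℤ.- + 1) k ≈F 0F
      vanishes k with k ℕP.≤? j'
      ... | no k≰j' = θ-vanishes-j' (+ j) j' (+ j'') (d ℤ.- + 1) k (ℕP.≰⇒> k≰j')
      ... | yes k≤j' = let (m , k+d-1<0) = negative k j' (s≤s k≤j') j''≡ij' in θ-vanishes-d (+ j) (+ j') (+ j'') (d ℤ.- + 1) k m k+d-1<0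

  -- At i = 0 both sides reduce to 1/(φ_{i'} φ_{i''} φ_{j''}): u has the
  -- single term n = 0 and T the single term k = j''.
  u≈T-initial : ∀ j j' i' j'' i'' → Balanced j 0 j' i' j'' i'' → uF j 0 j' i' j'' i'' ≈F T j 0 j' i' j'' i''
  u≈T-initial j j' i' j'' i'' (balanced i''j≡i'j' i'j''≡j i''j''≡j') = begin
    uF j 0 j' i' j'' i''
      ≈⟨ Expansion.expansion j 0 j' i' j'' i'' i''j≡i'j' 1 (s≤s z≤n) ⟩
    0F +F (1F *F φℤ (+ 0 ℤ.+ + j ℤ.- + 0) *F φ⁻¹ (+ 0) *F φ⁻¹ (+ 0 ℤ.- + 0) *F φ⁻¹ (+ i' ℤ.- + 0) *F R)
      ≈⟨ FR.refl ⟨+⟩ (FR.refl ⟨*⟩ ≈F-reflexive (cong φℤ (ℤP.+-identityʳ (+ j))) ⟨*⟩ φ⁻¹-0 ⟨*⟩ φ⁻¹-0 ⟨*⟩ ≈F-reflexive (cong φ⁻¹ (ℤP.+-identityʳ (+ i'))) ⟨*⟩ FR.refl) ⟩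
    0F +F (1F *F φF j *F 1F *F 1F *F φ⁻¹ (+ i') *F (φ⁻¹ (+ i'') *F φ⁻¹ (+ j) *F φ⁻¹ (+ j'')))
      ≈⟨ solve 5 (λ p a b c d → con (+ 0) :+ (con (+ 1) :* p :* con (+ 1) :* con (+ 1) :* a :* (b :* c :* d))
            := (p :* c) :* (d :* a :* b))
            FR.refl (φF j) (φ⁻¹ (+ i')) (φ⁻¹ (+ i'')) (φ⁻¹ (+ j)) (φ⁻¹ (+ j'')) ⟩
    (φF j *F φ⁻¹ (+ j)) *F (φ⁻¹ (+ j'') *F φ⁻¹ (+ i') *F φ⁻¹ (+ i''))
      ≈⟨ φ-φ⁻¹ j ⟨*⟩ FR.refl ⟩
    1F *F (φ⁻¹ (+ j'') *F φ⁻¹ (+ i') *F φ⁻¹ (+ i''))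
      ≈⟨ FR.*-identityˡ _ ⟩
    φ⁻¹ (+ j'') *F φ⁻¹ (+ i') *F φ⁻¹ (+ i'')
      ≈⟨ FR.sym diagonal ⟩
    θ (+ j) (+ j') (+ j'') d j''
      ≈⟨ FR.sym (sum-single (suc j) j'' _ (s≤s j''≤j) off-diagonal) ⟩
    T j 0 j' i' j'' i'' ∎
    where
    R : F
    R = φ⁻¹ (+ i'') *F φ⁻¹ (+ j) *F φ⁻¹ (+ j'')
    d : ℤ
    d = + 0 ℤ.- + j''
    j''≤j : j'' ≤ j
    j''≤j = subst (j'' ≤_) i'j''≡j (ℕP.m≤n+m j'' i')
    off-diagonal : ∀ k → k < suc j → ¬ (k ≡ j'') → θ (+ j) (+ j') (+ j'') d k ≈F 0F
    off-diagonal k _ k≢j'' with ℕP.<-cmp k j''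
    ... | tri< k<j'' _ _ with negative-difference k j'' k<j''
    ...   | m , k-j''<0 = θ-vanishes-d (+ j) (+ j') (+ j'') d k m (trans (zsolve 2 (λ k b → k +' (ι (+ 0) -' b) =' k -' b) refl (+ k) (+ j'')) k-j''<0)
    off-diagonal k _ k≢j'' | tri≈ _ k≡j'' _ = ⊥-elim (k≢j'' k≡j'')
    off-diagonal k _ k≢j'' | tri> _ _ j''<k = θ-vanishes-j'' (+ j) (+ j') j'' d k j''<k
    j-j'' : + j ℤ.- + j'' ≡ + i'
    j-j'' = trans (cong (ℤ._- + j'') (cong +_ (sym i'j''≡j))) (zsolve 2 (λ a b → (a +' b) -' b =' a) refl (+ i') (+ j''))
    j'-j'' : + j' ℤ.- + j'' ≡ + i''
    j'-j'' = trans (cong (ℤ._- + j'') (cong +_ (sym i''j''≡j'))) (zsolve 2 (λ a b → (a +' b) -' b =' a) refl (+ i'') (+ j''))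
    diagonal : θ (+ j) (+ j') (+ j'') d j'' ≈F φ⁻¹ (+ j'') *F φ⁻¹ (+ i') *F φ⁻¹ (+ i'')
    diagonal = begin
      θ (+ j) (+ j') (+ j'') d j''
        ≈⟨ FR.trans (tpow-cong (zsolve 1 (λ b → b *' (b +' (ι (+ 0) -' b)) =' ι (+ 0)) refl (+ j''))) tpow-0
           ⟨*⟩ FR.refl
           ⟨*⟩ FR.trans (≈F-reflexive (cong φ⁻¹ (zsolve 1 (λ b → b +' (ι (+ 0) -' b) =' ι (+ 0)) refl (+ j'')))) φ⁻¹-0
           ⟨*⟩ ≈F-reflexive (cong φ⁻¹ j-j'') ⟨*⟩ ≈F-reflexive (cong φ⁻¹ j'-j'')
           ⟨*⟩ FR.trans (≈F-reflexive (cong φ⁻¹ (ℤP.+-inverseʳ (+ j'')))) φ⁻¹-0 ⟩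
      1F *F φ⁻¹ (+ j'') *F 1F *F φ⁻¹ (+ i') *F φ⁻¹ (+ i'') *F 1F
        ≈⟨ solve 3 (λ a b c → con (+ 1) :* a :* con (+ 1) :* b :* c :* con (+ 1) := a :* b :* c) FR.refl _ _ _ ⟩
      φ⁻¹ (+ j'') *F φ⁻¹ (+ i') *F φ⁻¹ (+ i'') ∎

  u≈T : ∀ j i j' i' j'' i'' → Balanced j i j' i' j'' i'' → uF j i j' i' j'' i'' ≈F T j i j' i' j'' i''
  u≈T = contiguous-unique uF T u-contiguous T-contiguous u≈T-initial

  -- The reflection fixing j swaps j'
  -- and j''; the rotation by one step exchanges the roles of the j's and
  -- the i's, which is the shift symmetry of Θ followed by a cyclic one.
  T-reflect : ∀ j i j' i' j'' i'' → Balanced j i j' i' j'' i'' → T j i'' j'' i' j' i ≈F T j i j' i' j'' i''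
  T-reflect j i j' i' j'' i'' bal = begin
    Θ (suc j) (+ j) (+ j'') (+ j') (+ i'' ℤ.- + j')  ≈⟨ ≈F-reflexive (cong (Θ (suc j) (+ j) (+ j'') (+ j')) same-offset) ⟩
    Θ (suc j) (+ j) (+ j'') (+ j') (+ i ℤ.- + j'')   ≈⟨ Θ-swap (suc j) (+ j) (+ j'') (+ j') (+ i ℤ.- + j'') ⟩
    Θ (suc j) (+ j) (+ j') (+ j'') (+ i ℤ.- + j'')   ∎
    where
    same-offset : + i'' ℤ.- + j' ≡ + i ℤ.- + j''
    same-offset = sums⇒differences i'' j' i j'' (i''j''≡ij' bal)

  private
    rotate-up : ∀ j j' j'' D i i' i'' → i ≡ j'' ℕ.+ D → i' ≡ j ℕ.+ D → i'' ≡ j' ℕ.+ D →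
                T i j' i' j'' i'' j ≈F T j i j' i' j'' i''
    rotate-up j j' j'' D _ _ _ refl refl refl = begin
      Θ (suc (j'' ℕ.+ D)) (+ (j'' ℕ.+ D)) (+ (j ℕ.+ D)) (+ (j' ℕ.+ D)) (+ j' ℤ.- + (j' ℕ.+ D))
        ≈⟨ ≈F-reflexive (cong (Θ (suc (j'' ℕ.+ D)) (+ (j'' ℕ.+ D)) (+ (j ℕ.+ D)) (+ (j' ℕ.+ D))) (zsolve 2 (λ a d → a -' (a +' d) =' -' d) refl (+ j') (+ D))) ⟩
      Θ (suc (j'' ℕ.+ D)) (+ (j'' ℕ.+ D)) (+ (j ℕ.+ D)) (+ (j' ℕ.+ D)) (ℤ.- + D)
        ≈⟨ Θ-shift j'' j j' D ⟩
      Θ (suc j'') (+ j'') (+ j) (+ j') (+ D)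
        ≈⟨ Θ-cyclic j'' j j' (+ D) ⟩
      Θ (suc j) (+ j) (+ j') (+ j'') (+ D)
        ≈⟨ ≈F-reflexive (cong (Θ (suc j) (+ j) (+ j') (+ j'')) (zsolve 2 (λ a d → d =' (a +' d) -' a) refl (+ j'') (+ D))) ⟩
      Θ (suc j) (+ j) (+ j') (+ j'') (+ (j'' ℕ.+ D) ℤ.- + j'') ∎

    rotate-down : ∀ i i' i'' D j j' j'' → j'' ≡ i ℕ.+ D → j ≡ i' ℕ.+ D → j' ≡ i'' ℕ.+ D →
                  T i j' i' j'' i'' j ≈F T j i j' i' j'' i''
    rotate-down i i' i'' D _ _ _ refl refl refl = begin
      Θ (suc i) (+ i) (+ i') (+ i'') (+ (i'' ℕ.+ D) ℤ.- + i'')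
        ≈⟨ ≈F-reflexive (cong (Θ (suc i) (+ i) (+ i') (+ i'')) (zsolve 2 (λ a d → (a +' d) -' a =' d) refl (+ i'') (+ D))) ⟩
      Θ (suc i) (+ i) (+ i') (+ i'') (+ D)
        ≈⟨ Θ-cyclic i i' i'' (+ D) ⟩
      Θ (suc i') (+ i') (+ i'') (+ i) (+ D)
        ≈⟨ FR.sym (Θ-shift i' i'' i D) ⟩
      Θ (suc (i' ℕ.+ D)) (+ (i' ℕ.+ D)) (+ (i'' ℕ.+ D)) (+ (i ℕ.+ D)) (ℤ.- + D)
        ≈⟨ ≈F-reflexive (cong (Θ (suc (i' ℕ.+ D)) (+ (i' ℕ.+ D)) (+ (i'' ℕ.+ D)) (+ (i ℕ.+ D))) (zsolve 2 (λ a d → -' d =' a -' (a +' d)) refl (+ i) (+ D))) ⟩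
      Θ (suc (i' ℕ.+ D)) (+ (i' ℕ.+ D)) (+ (i'' ℕ.+ D)) (+ (i ℕ.+ D)) (+ i ℤ.- + (i ℕ.+ D)) ∎

    offset : ∀ x y z D → x ℕ.+ z ≡ (z ℕ.+ D) ℕ.+ y → x ≡ y ℕ.+ D
    offset x y z D e = ℕP.+-cancelʳ-≡ z x (y ℕ.+ D) (trans e (trans (ℕP.+-assoc z D y)
                         (trans (ℕP.+-comm z (D ℕ.+ y)) (cong (ℕ._+ z) (ℕP.+-comm D y)))))

    offset' : ∀ x y z D → y ℕ.+ (z ℕ.+ D) ≡ z ℕ.+ x → x ≡ y ℕ.+ D
    offset' x y z D e = ℕP.+-cancelˡ-≡ z x (y ℕ.+ D) (trans (sym e) (trans (ℕP.+-comm y (z ℕ.+ D))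
                          (trans (ℕP.+-assoc z D y) (cong (z ℕ.+_) (ℕP.+-comm D y)))))

  T-rotate : ∀ j i j' i' j'' i'' → Balanced j i j' i' j'' i'' → T i j' i' j'' i'' j ≈F T j i j' i' j'' i''
  T-rotate j i j' i' j'' i'' (balanced i''j≡i'j' i'j''≡ij i''j''≡ij') with ℕP.≤-total j'' i
  ... | inj₁ j''≤i = rotate-up j j' j'' D i i' i'' (sym j''+D≡i)
                        (offset i' j j'' D (trans i'j''≡ij (cong (ℕ._+ j) (sym j''+D≡i))))
                        (offset i'' j' j'' D (trans i''j''≡ij' (cong (ℕ._+ j') (sym j''+D≡i))))
    where
    D : ℕ
    D = i ℕ.∸ j''
    j''+D≡i : j'' ℕ.+ D ≡ i
    j''+D≡i = ℕP.m+[n∸m]≡n j''≤i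
  ... | inj₂ i≤j'' = rotate-down i i' i'' D j j' j'' (sym i+D≡j'')
                        (offset' j i' i D (trans (cong (i' ℕ.+_) i+D≡j'') i'j''≡ij))
                        (offset' j' i'' i D (trans (cong (i'' ℕ.+_) i+D≡j'') i''j''≡ij'))
    where
    D : ℕ
    D = j'' ℕ.∸ i
    i+D≡j'' : i ℕ.+ D ≡ j''
    i+D≡j'' = ℕP.m+[n∸m]≡n i≤j''

  Balanced-rotate : ∀ {j i j' i' j'' i''} → Balanced j i j' i' j'' i'' → Balanced i j' i' j'' i'' j
  Balanced-rotate {j} {i} {j'} {i'} {j''} {i''} (balanced i''j≡i'j' i'j''≡ij i''j''≡ij') = balanced
    (trans (ℕP.+-comm j i) (trans (sym i'j''≡ij) (ℕP.+-comm i' j'')))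
    (trans (ℕP.+-comm j'' i'') (trans i''j''≡ij' (ℕP.+-comm i j')))
    (trans (ℕP.+-comm j i'') (trans i''j≡i'j' (ℕP.+-comm i' j')))

  Balanced-reflect : ∀ {j i j' i' j'' i''} → Balanced j i j' i' j'' i'' → Balanced j i'' j'' i' j' i
  Balanced-reflect (balanced i''j≡i'j' i'j''≡ij i''j''≡ij') = balanced (sym i'j''≡ij) (sym i''j≡i'j') (sym i''j''≡ij')

-- Step 4: invariance under the dihedral group.

open Fractions
open PowersAndSums
open LiftOfU
open ContiguousRelation
open Identification

Labelling : Set
Labelling = Fin 6 → ℕ

on : Hexagonal → Labelling → F
on X x = X (x (# 0)) (x (# 1)) (x (# 2)) (x (# 3)) (x (# 4)) (x (# 5))

BalancedAt : Labelling → Set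
BalancedAt x = Balanced (x (# 0)) (x (# 1)) (x (# 2)) (x (# 3)) (x (# 4)) (x (# 5))

Weight⇒Balanced : ∀ x → Weight x → BalancedAt x
Weight⇒Balanced x (e₁ , e₂) = balanced
  (sym (differences⇒sums (x (# 3)) (x (# 0)) (x (# 5)) (x (# 2)) e₁))
  (differences⇒sums (x (# 3)) (x (# 0)) (x (# 1)) (x (# 4)) (trans e₁ e₂))
  (differences⇒sums (x (# 5)) (x (# 2)) (x (# 1)) (x (# 4)) e₂)

rotate reflect : Labelling → Labelling
rotate  = act (# 1 , false)
reflect = act (# 0 , true)

_∼_ : Labelling → Labelling → Set
x ∼ y = BalancedAt y × on T y ≈F on T x

∼-rotate : ∀ x y → x ∼ y → x ∼ rotate y
∼-rotate x y (bal , Ty≈Tx) =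
  Balanced-rotate bal , FR.trans (T-rotate (y (# 0)) (y (# 1)) (y (# 2)) (y (# 3)) (y (# 4)) (y (# 5)) bal) Ty≈Tx

∼-reflect : ∀ x y → x ∼ y → x ∼ reflect y
∼-reflect x y (bal , Ty≈Tx) =
  Balanced-reflect bal , FR.trans (T-reflect (y (# 0)) (y (# 1)) (y (# 2)) (y (# 3)) (y (# 4)) (y (# 5)) bal) Ty≈Tx

rotations : ℕ → Labelling → Labelling
rotations zero    x = x
rotations (suc n) x = rotate (rotations n x)

∼-rotations : ∀ x → BalancedAt x → ∀ n → x ∼ rotations n x
∼-rotations x bal zero    = bal , FR.refl
∼-rotations x bal (suc n) = ∼-rotate x (rotations n x) (∼-rotations x bal n)

-- Every element of D6 is a power of the rotation, possibly followed by the
-- reflection; on each explicit group element both sides compute to the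
-- same relabelling.
dihedral : ∀ x → BalancedAt x → ∀ g → x ∼ act g x
dihedral x bal (r , false) = rotation r
  where
  rotation : ∀ r → x ∼ act (r , false) x
  rotation Fin.zero                                        = ∼-rotations x bal 0
  rotation (Fin.suc Fin.zero)                              = ∼-rotations x bal 1
  rotation (Fin.suc (Fin.suc Fin.zero))                    = ∼-rotations x bal 2
  rotation (Fin.suc (Fin.suc (Fin.suc Fin.zero)))          = ∼-rotations x bal 3
  rotation (Fin.suc (Fin.suc (Fin.suc (Fin.suc Fin.zero)))) = ∼-rotations x bal 4
  rotation (Fin.suc (Fin.suc (Fin.suc (Fin.suc (Fin.suc Fin.zero))))) = ∼-rotations x bal 5
dihedral x bal (r , true) = reflection r
  where
  reflection : ∀ r → x ∼ act (r , true) x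
  reflection Fin.zero                                        = ∼-reflect x (rotations 0 x) (∼-rotations x bal 0)
  reflection (Fin.suc Fin.zero)                              = ∼-reflect x (rotations 1 x) (∼-rotations x bal 1)
  reflection (Fin.suc (Fin.suc Fin.zero))                    = ∼-reflect x (rotations 2 x) (∼-rotations x bal 2)
  reflection (Fin.suc (Fin.suc (Fin.suc Fin.zero)))          = ∼-reflect x (rotations 3 x) (∼-rotations x bal 3)
  reflection (Fin.suc (Fin.suc (Fin.suc (Fin.suc Fin.zero)))) = ∼-reflect x (rotations 4 x) (∼-rotations x bal 4)
  reflection (Fin.suc (Fin.suc (Fin.suc (Fin.suc (Fin.suc Fin.zero))))) = ∼-reflect x (rotations 5 x) (∼-rotations x bal 5)

raw-on-u : ∀ x → raw (on uF x) ≡ uHex x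
raw-on-u x = raw-u (x (# 0)) (x (# 1)) (x (# 2)) (x (# 3)) (x (# 4)) (x (# 5))

u≈T-at : ∀ x → BalancedAt x → on uF x ≈F on T x
u≈T-at x = u≈T (x (# 0)) (x (# 1)) (x (# 2)) (x (# 3)) (x (# 4)) (x (# 5))

lemma5 : (x : Fin 6 → ℕ) → Weight x → (g : D6) → uHex (act g x) ≈R uHex x
lemma5 x w g = subst₂ _≈R_ (raw-on-u (act g x)) (raw-on-u x) (≈F⇒≈R _ _ (begin
  on uF (act g x)  ≈⟨ u≈T-at (act g x) bal-g ⟩
  on T (act g x)   ≈⟨ Tg≈T ⟩
  on T x           ≈⟨ FR.sym (u≈T-at x bal) ⟩
  on uF x          ∎))
  where
  bal : BalancedAt x
  bal = Weight⇒Balanced x w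
  bal-g : BalancedAt (act g x)
  bal-g = proj₁ (dihedral x bal g)
  Tg≈T : on T (act g x) ≈F on T x
  Tg≈T = proj₂ (dihedral x bal g)
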